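{- Let $U(k,n)$ be the uniform matroid of rank $k$ on the ground set $[n]$. Then the combinatorial derived matroid $\delta U(k,n)$ is an adjoint of $U(k,n)$.
   Context: For a matroid $\mathcal M$ on ground set $E$ with $n=|E|$, $d=\mathrm{rank}(\mathcal M)$ and set of circuits $\mathcal C(\mathcal M)$, define $\mathcal S(\mathcal M)=\{\mathcal S\subseteq\mathcal C(\mathcal M): |\mathcal S|\le (n-d)-r_{\mathcal M^*}(\bigcap_{C\in\mathcal S}(E\setminus C))\}$ (empty intersection $=E$), where $\mathcal M^*$ is the dual matroid. For a collection $\mathfrak A$ of subsets of $\mathcal C(\mathcal M)$ let $\epsilon(\mathfrak A)=\mathfrak A\cup\{(\mathcal A_1\cup\mathcal A_2)\setminus\{C\}: \mathcal A_1,\mathcal A_2\in\mathfrak A,\ \mathcal A_1\cap\mathcal A_2\notin\mathfrak A,\ C\in\mathcal A_1\cap\mathcal A_2\}$ and $\uparrow\mathfrak A=\{\mathcal A\subseteq\mathcal C(\mathcal M):\exists\mathcal A'\in\mathfrak A,\ \mathcal A'\subseteq\mathcal A\}$. Set $\mathfrak A_0=\mathfrak A$, $\mathfrak A_{i+1}=\uparrow\epsilon(\mathfrak A_i)$, $D(\mathfrak A)=\bigcup_{i\ge0}\mathfrak A_i$; it is known that if $\emptyset\notin\mathfrak A$ then $D(\mathfrak A)$ is the family of dependent sets of a matroid on $\mathcal C(\mathcal M)$. The combinatorial derived matroid $\delta\mathcal M$ is the matroid on $\mathcal C(\mathcal M)$ with dependent sets $D(2^{\mathcal C(\mathcal M)}\setminus\mathcal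 S(\mathcal M))$. Adjoint: let $\mathcal L^*$ be the lattice of flats of $\mathcal M^*$ and $(\mathcal L^*)^{opp}$ its order dual (rank function $(n-d)-r_{\mathcal M^*}$), whose atoms are the hyperplanes $E\setminus C$ of $\mathcal M^*$, $C\in\mathcal C(\mathcal M)$. A matroid $\mathcal N$ on $\mathcal C(\mathcal M)$ with lattice of flats $\mathcal L(\mathcal N)$ is an adjoint of $\mathcal M$ if the map $E\setminus C\mapsto\mathrm{cl}_{\mathcal N}(\{C\})$ is a bijection from the atoms of $(\mathcal L^*)^{opp}$ onto the atoms of $\mathcal L(\mathcal N)$ and extends to a rank-preserving order embedding $f:(\mathcal L^*)^{opp}\to\mathcal L(\mathcal N)$ ($x\le y\iff f(x)\le f(y)$, ranks preserved). -}

module Defs where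

open import Data.Nat using (ℕ; zero; suc; _+_; _∸_; _≤_; _<_; _⊓_)
open import Data.Bool using (Bool; true; false; _∧_; _∨_; not; if_then_else_)
open import Data.Bool.Properties using () renaming (_≟_ to _≟ᵇ_)
open import Data.Fin using (Fin)
open import Data.Fin.Subset using (Subset; ∣_∣; _∈_; _∉_; _⊆_; _∪_; _∩_; ∁; ⁅_⁆; ⊤)
open import Data.List using (List; []; _∷_; _++_; map; foldr)
open import Data.Nat.ListAction using (sum)
open import Data.Vec using (Vec; []; _∷_)
open import Data.Vec.Properties using (≡-dec)
open import Data.Product using (Σ; _×_; _,_)
open import Data.Sum using (_⊎_)
open import Relation.Nullary using (¬_; Dec)
open import Relation.Nullary.Decidable using (⌊_⌋)
open import Relation.Binary.PropositionalEquality using (_≡_; _≢_)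
open import Function.Bundles using (_⇔_)

-- Matroids on the ground set E = [n] = Fin n, given by rank functions.

rankU : (k : ℕ) {n : ℕ} → Subset n → ℕ
rankU k X = k ⊓ ∣ X ∣

module _ {n : ℕ} (rk : Subset n → ℕ) where

  rankM : ℕ
  rankM = rk ⊤

  dualRank : Subset n → ℕ
  dualRank X = ∣ X ∣ + rk (∁ X) ∸ rk ⊤

  Independent : Subset n → Set
  Independent X = rk X ≡ ∣ X ∣

  IsCircuit : Subset n → Set
  IsCircuit C = ¬ Independent C × (∀ Y → Y ⊆ C → Y ≢ C → Independent Y)

IsFlat : {n : ℕ} (rk : Subset n → ℕ) → Subset n → Set
IsFlat {n} rk F = ∀ (e : Fin n) → e ∉ F → rk (F ∪ ⁅ e ⁆) ≢ rk F

-- Collections of subsets of [n] (in particular, of circuits), represented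
-- by their Boolean characteristic function on Subset n.

Fam : ℕ → Set
Fam n = Subset n → Bool

allSubsets : (n : ℕ) → List (Subset n)
allSubsets zero = [] ∷ []
allSubsets (suc n) = map (true ∷_) (allSubsets n) ++ map (false ∷_) (allSubsets n)

module _ {n : ℕ} where

  _≟ˢ_ : (X Y : Subset n) → Dec (X ≡ Y)
  _≟ˢ_ = ≡-dec _≟ᵇ_

  _∈ᶠ_ : Subset n → Fam n → Set
  X ∈ᶠ 𝒜 = 𝒜 X ≡ true

  _∉ᶠ_ : Subset n → Fam n → Set
  X ∉ᶠ 𝒜 = ¬ (X ∈ᶠ 𝒜)

  _⊆ᶠ_ : Fam n → Fam n → Set
  𝒜 ⊆ᶠ ℬ = ∀ X → X ∈ᶠ 𝒜 → X ∈ᶠ ℬ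

  _≐_ : Fam n → Fam n → Set
  𝒜 ≐ ℬ = ∀ X → 𝒜 X ≡ ℬ X

  _∪ᶠ_ : Fam n → Fam n → Fam n
  (𝒜 ∪ᶠ ℬ) X = 𝒜 X ∨ ℬ X

  _∩ᶠ_ : Fam n → Fam n → Fam n
  (𝒜 ∩ᶠ ℬ) X = 𝒜 X ∧ ℬ X

  _∖ᶠ_ : Fam n → Subset n → Fam n
  (𝒜 ∖ᶠ C) X = 𝒜 X ∧ not ⌊ X ≟ˢ C ⌋

  ⁅_⁆ᶠ : Subset n → Fam n
  ⁅ C ⁆ᶠ X = ⌊ X ≟ˢ C ⌋

  ∣_∣ᶠ : Fam n → ℕ
  ∣ 𝒜 ∣ᶠ = sum (map (λ X → if 𝒜 X then 1 else 0) (allSubsets n))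

  ⋂∁ : Fam n → Subset n
  ⋂∁ 𝒜 = foldr (λ X acc → if 𝒜 X then ∁ X ∩ acc else acc) ⊤ (allSubsets n)

module _ {n : ℕ} (rk : Subset n → ℕ) where

  OfCircuits : Fam n → Set
  OfCircuits 𝒜 = ∀ C → C ∈ᶠ 𝒜 → IsCircuit rk C

  ε : (Fam n → Set) → (Fam n → Set)
  ε 𝔄 ℬ = 𝔄 ℬ ⊎
    Σ (Fam n) λ 𝒜₁ → Σ (Fam n) λ 𝒜₂ → Σ (Subset n) λ C →
      𝔄 𝒜₁ × 𝔄 𝒜₂ × ¬ 𝔄 (𝒜₁ ∩ᶠ 𝒜₂) × C ∈ᶠ 𝒜₁ × C ∈ᶠ 𝒜₂ ×
      ℬ ≐ ((𝒜₁ ∪ᶠ 𝒜₂) ∖ᶠ C)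

  ↑ : (Fam n → Set) → (Fam n → Set)
  ↑ 𝔄 𝒜 = OfCircuits 𝒜 × Σ (Fam n) λ 𝒜' → 𝔄 𝒜' × 𝒜' ⊆ᶠ 𝒜

  stage : (Fam n → Set) → ℕ → (Fam n → Set)
  stage 𝔄 zero = 𝔄
  stage 𝔄 (suc i) = ↑ (ε (stage 𝔄 i))

  D : (Fam n → Set) → (Fam n → Set)
  D 𝔄 𝒜 = Σ ℕ λ i → stage 𝔄 i 𝒜

  InS : Fam n → Set
  InS 𝒮 = OfCircuits 𝒮 × ∣ 𝒮 ∣ᶠ ≤ (n ∸ rankM rk) ∸ dualRank rk (⋂∁ 𝒮)

  notS : Fam n → Set
  notS 𝒜 = OfCircuits 𝒜 × ¬ InS 𝒜

  DependentDM : Fam n → Set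
  DependentDM = D notS

  IndependentDM : Fam n → Set
  IndependentDM ℐ = OfCircuits ℐ × ¬ DependentDM ℐ

  RankDMIs : Fam n → ℕ → Set
  RankDMIs 𝒳 r =
    (Σ (Fam n) λ ℐ → ℐ ⊆ᶠ 𝒳 × IndependentDM ℐ × ∣ ℐ ∣ᶠ ≡ r) ×
    (∀ ℐ → ℐ ⊆ᶠ 𝒳 → IndependentDM ℐ → ∣ ℐ ∣ᶠ ≤ r)

  InClDM : Fam n → Subset n → Set
  InClDM 𝒳 C = IsCircuit rk C × Σ ℕ λ r → RankDMIs 𝒳 r × RankDMIs (𝒳 ∪ᶠ ⁅ C ⁆ᶠ) r

  IsFlatDM : Fam n → Set
  IsFlatDM 𝒳 = OfCircuits 𝒳 × (∀ C → IsCircuit rk C → (C ∈ᶠ 𝒳 ⇔ InClDM 𝒳 C))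

  IsClDM : Fam n → Fam n → Set
  IsClDM 𝒳 𝒴 = OfCircuits 𝒳 × (∀ C → IsCircuit rk C → (C ∈ᶠ 𝒳 ⇔ InClDM 𝒴 C))

  IsAtomDM : Fam n → Set
  IsAtomDM 𝒳 = IsFlatDM 𝒳 × RankDMIs 𝒳 1

  IsAdjointDM : Set
  IsAdjointDM =
    -- the map E∖C ↦ cl_{δM}({C}) is a bijection from the atoms of
    -- (L*)^opp onto the atoms of L(δM):
    (∀ C → IsCircuit rk C → Σ (Fam n) λ 𝒳 → IsClDM 𝒳 ⁅ C ⁆ᶠ × IsAtomDM 𝒳) ×
    (∀ C C' 𝒳 → IsCircuit rk C → IsCircuit rk C' → IsClDM 𝒳 ⁅ C ⁆ᶠ → IsClDM 𝒳 ⁅ C' ⁆ᶠ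
       → ∁ C ≡ ∁ C') ×
    (∀ 𝒳 → IsAtomDM 𝒳 → Σ (Subset n) λ C → IsCircuit rk C × IsClDM 𝒳 ⁅ C ⁆ᶠ) ×
    -- and it extends to a rank-preserving order embedding
    -- f : (L*)^opp → L(δM)
    (Σ (Subset n → Fam n) λ f →
       (∀ F → IsFlat (dualRank rk) F → IsFlatDM (f F)) ×
       (∀ F G → IsFlat (dualRank rk) F → IsFlat (dualRank rk) G →
          (G ⊆ F ⇔ f F ⊆ᶠ f G)) ×
       (∀ F → IsFlat (dualRank rk) F →
          RankDMIs (f F) ((n ∸ rankM rk) ∸ dualRank rk F)) ×
       (∀ C → IsCircuit rk C → IsClDM (f (∁ C)) ⁅ C ⁆ᶠ))

{-# OPTIONS --safe #-}
module Submission where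

-- For U(k,n) the circuits are the (k+1)-subsets of [n], and the bound (n − d) − r*(⋂_{C∈𝒜} E∖C)
-- in the definition of 𝒮 equals |⋃𝒜| − k; call 𝒜 overfull when |𝒜| exceeds it. Submodularity of
-- 𝒜 ↦ |⋃𝒜| shows that if 𝒜₁, 𝒜₂ are overfull, share a circuit C, and 𝒜₁ ∩ 𝒜₂ is not overfull,
-- then (𝒜₁ ∪ 𝒜₂) ∖ {C} is overfull. Hence the closure D creates nothing new: the dependent sets of
-- δU(k,n) are the collections of circuits containing an overfull one. An independent collection
-- stays independent when a circuit with a point outside all its members is added, so the circuits
-- inside X ⊆ [n] form a flat of rank |X| − k, an atom contains a single circuit, and
-- F ↦ {circuits inside [n] ∖ F} is the required rank-preserving embedding of (L*)^opp.

open import Defs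
open import Data.Nat using (ℕ; zero; suc; _+_; _∸_; _≤_; _<_; _⊓_; z≤n; s≤s; _≤?_; _≟_)
open import Data.Nat.Properties
open import Data.Nat.ListAction using (sum)
open import Data.Nat.ListAction.Properties using (sum-++)
open import Data.Nat.Tactic.RingSolver using (solve-∀)
open import Data.Bool using (Bool; true; false; _∧_; _∨_; not; if_then_else_)
open import Data.Bool.Properties using (∨-zeroʳ; not-¬) renaming (_≟_ to _≟ᵇ_)
open import Data.Fin using (Fin; zero; suc)
open import Data.Fin.Properties using (¬∀⟶∃¬)
open import Data.Fin.Subset using (Subset; ∣_∣; _∈_; _∉_; _⊆_; _∪_; _∩_; _-_; ∁; ⁅_⁆; ⊤; ⊥; Nonempty)
open import Data.Fin.Subset.Properties
open import Data.List using (List; []; _∷_; _++_; map; foldr)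
open import Data.List.Properties using (map-++; map-∘)
open import Data.List.Membership.Propositional using () renaming (_∈_ to _∈ₗ_)
open import Data.List.Membership.Propositional.Properties using (∈-++⁺ˡ; ∈-++⁺ʳ; ∈-map⁺)
open import Data.List.Relation.Unary.Any using (here; there)
open import Data.Vec using ([]; _∷_; here; there)
open import Data.Vec.Properties using (∷-injectiveˡ; ∷-injectiveʳ)
open import Data.Product using (Σ; _×_; _,_; proj₁; proj₂)
open import Data.Sum using (_⊎_; inj₁; inj₂)
open import Function using (_∘_; case_of_)
open import Function.Bundles using (_⇔_; mk⇔; Equivalence)
open import Relation.Nullary using (¬_; Dec; yes; no; contradiction)
open import Relation.Nullary.Decidable using (⌊_⌋; decidable-stable; _→-dec_)
open import Relation.Binary.PropositionalEquality
import Algebra.Lattice.Properties.BooleanAlgebra as BooleanAlgebra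

[a+c∸k]∸[a+k⊓c∸k]≡c∸k : ∀ a c k → (a + c ∸ k) ∸ (a + k ⊓ c ∸ k) ≡ c ∸ k
[a+c∸k]∸[a+k⊓c∸k]≡c∸k a c k with ≤-total k c
... | inj₁ k≤c rewrite m≤n⇒m⊓n≡m k≤c | m+n∸n≡m a k | +-∸-assoc a k≤c = m+n∸m≡n a (c ∸ k)
... | inj₂ c≤k rewrite m≥n⇒m⊓n≡n c≤k | n∸n≡0 (a + c ∸ k) = sym (m≤n⇒m∸n≡0 c≤k)

-- aᵢ = |𝒜ᵢ|, i = |𝒜₁ ∩ 𝒜₂|, r = |(𝒜₁ ∪ 𝒜₂) ∖ {C}|, and u₁, u₂, u, u∩ are the sizes of the unions
-- of 𝒜₁, 𝒜₂, 𝒜₁ ∪ 𝒜₂, 𝒜₁ ∩ 𝒜₂.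
elimination-arithmetic : ∀ {a₁ a₂ i r u₁ u₂ u u∩ k} → suc r + i ≡ a₁ + a₂ →
  u₁ < a₁ + k → u₂ < a₂ + k → i + k ≤ u∩ → u + u∩ ≤ u₁ + u₂ → u < r + k
elimination-arithmetic {a₁} {a₂} {i} {r} {u₁} {u₂} {u} {u∩} {k}
                       r+i≡a₁+a₂ u₁<a₁+k u₂<a₂+k i+k≤u∩ u+u∩≤u₁+u₂ =
  +-cancelʳ-≤ (suc (i + k)) (suc u) (r + k) (begin
    suc u + suc (i + k)       ≡⟨ cong suc (+-suc u (i + k)) ⟩
    suc (suc (u + (i + k)))   ≤⟨ s≤s (s≤s (+-monoʳ-≤ u i+k≤u∩)) ⟩
    suc (suc (u + u∩))        ≤⟨ s≤s (s≤s u+u∩≤u₁+u₂) ⟩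
    suc (suc (u₁ + u₂))       ≡⟨ cong suc (+-suc u₁ u₂) ⟨
    suc u₁ + suc u₂           ≤⟨ +-mono-≤ u₁<a₁+k u₂<a₂+k ⟩
    (a₁ + k) + (a₂ + k)       ≡⟨ interchange a₁ a₂ k ⟩
    (a₁ + a₂) + (k + k)       ≡⟨ cong (_+ (k + k)) r+i≡a₁+a₂ ⟨
    (suc r + i) + (k + k)     ≡⟨ regroup r i k ⟩
    (r + k) + suc (i + k)     ∎)
  where
  open ≤-Reasoning
  interchange : ∀ a b k → (a + k) + (b + k) ≡ (a + b) + (k + k)
  interchange = solve-∀
  regroup : ∀ r i k → (suc r + i) + (k + k) ≡ (r + k) + suc (i + k)
  regroup = solve-∀

m<n∧o<n⇒m∸o<n∸o : ∀ {m n o} → m < n → o < n → m ∸ o < n ∸ o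
m<n∧o<n⇒m∸o<n∸o {m} {n} {o} m<n o<n with o ≤? m
... | yes o≤m = ∸-monoˡ-< m<n o≤m
... | no o≰m = subst (_< n ∸ o) (sym (m≤n⇒m∸n≡0 (<⇒≤ (≰⇒> o≰m)))) (m<n⇒0<n∸m o<n)

private variable
  n : ℕ

∣p∪q∣+∣p∩q∣≡∣p∣+∣q∣ : (p q : Subset n) → ∣ p ∪ q ∣ + ∣ p ∩ q ∣ ≡ ∣ p ∣ + ∣ q ∣
∣p∪q∣+∣p∩q∣≡∣p∣+∣q∣ [] [] = refl
∣p∪q∣+∣p∩q∣≡∣p∣+∣q∣ (true ∷ p) (true ∷ q) = cong suc (begin
  ∣ p ∪ q ∣ + suc ∣ p ∩ q ∣ ≡⟨ +-suc ∣ p ∪ q ∣ ∣ p ∩ q ∣ ⟩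
  suc (∣ p ∪ q ∣ + ∣ p ∩ q ∣) ≡⟨ cong suc (∣p∪q∣+∣p∩q∣≡∣p∣+∣q∣ p q) ⟩
  suc (∣ p ∣ + ∣ q ∣) ≡⟨ +-suc ∣ p ∣ ∣ q ∣ ⟨
  ∣ p ∣ + suc ∣ q ∣ ∎)
  where open ≡-Reasoning
∣p∪q∣+∣p∩q∣≡∣p∣+∣q∣ (true ∷ p) (false ∷ q) = cong suc (∣p∪q∣+∣p∩q∣≡∣p∣+∣q∣ p q)
∣p∪q∣+∣p∩q∣≡∣p∣+∣q∣ (false ∷ p) (true ∷ q) =
  trans (cong suc (∣p∪q∣+∣p∩q∣≡∣p∣+∣q∣ p q)) (sym (+-suc ∣ p ∣ ∣ q ∣))
∣p∪q∣+∣p∩q∣≡∣p∣+∣q∣ (false ∷ p) (false ∷ q) = ∣p∪q∣+∣p∩q∣≡∣p∣+∣q∣ p q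

∣p∣+∣∁p∣≡n : (p : Subset n) → ∣ p ∣ + ∣ ∁ p ∣ ≡ n
∣p∣+∣∁p∣≡n p = trans (cong (∣ p ∣ +_) (∣∁p∣≡n∸∣p∣ p)) (m+[n∸m]≡n (∣p∣≤n p))

p⊆q∧∣p∣≡∣q∣⇒p≡q : {p q : Subset n} → p ⊆ q → ∣ p ∣ ≡ ∣ q ∣ → p ≡ q
p⊆q∧∣p∣≡∣q∣⇒p≡q {p = []} {[]} _ _ = refl
p⊆q∧∣p∣≡∣q∣⇒p≡q {p = true ∷ p} {true ∷ q} p⊆q eq =
  cong (true ∷_) (p⊆q∧∣p∣≡∣q∣⇒p≡q (drop-∷-⊆ p⊆q) (suc-injective eq))
p⊆q∧∣p∣≡∣q∣⇒p≡q {p = true ∷ p} {false ∷ q} p⊆q eq with () ← p⊆q here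
p⊆q∧∣p∣≡∣q∣⇒p≡q {p = false ∷ p} {true ∷ q} p⊆q eq =
  contradiction eq (<⇒≢ (s≤s (p⊆q⇒∣p∣≤∣q∣ (drop-∷-⊆ p⊆q))))
p⊆q∧∣p∣≡∣q∣⇒p≡q {p = false ∷ p} {false ∷ q} p⊆q eq =
  cong (false ∷_) (p⊆q∧∣p∣≡∣q∣⇒p≡q (drop-∷-⊆ p⊆q) eq)

∃-⊆-of-size : ∀ m (p : Subset n) → m ≤ ∣ p ∣ → Σ (Subset n) λ q → q ⊆ p × ∣ q ∣ ≡ m
∃-⊆-of-size {n} zero p _ = ⊥ , ⊆-min p , ∣⊥∣≡0 n
∃-⊆-of-size (suc m) (true ∷ p) (s≤s m≤∣p∣) with q , q⊆p , ∣q∣≡m ← ∃-⊆-of-size m p m≤∣p∣ =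
  true ∷ q , in⊆in q⊆p , cong suc ∣q∣≡m
∃-⊆-of-size (suc m) (false ∷ p) m<∣p∣ with q , q⊆p , ∣q∣≡m ← ∃-⊆-of-size (suc m) p m<∣p∣ =
  false ∷ q , out⊆ q⊆p , ∣q∣≡m

∣p∪⁅x⁆∣≡1+∣p∣ : {x : Fin n} (p : Subset n) → x ∉ p → ∣ p ∪ ⁅ x ⁆ ∣ ≡ suc ∣ p ∣
∣p∪⁅x⁆∣≡1+∣p∣ {x = zero} (true ∷ p) x∉p = contradiction here x∉p
∣p∪⁅x⁆∣≡1+∣p∣ {x = zero} (false ∷ p) _ = cong (suc ∘ ∣_∣) (∪-identityʳ p)
∣p∪⁅x⁆∣≡1+∣p∣ {x = suc x} (true ∷ p) x∉p = cong suc (∣p∪⁅x⁆∣≡1+∣p∣ p (x∉p ∘ there))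
∣p∪⁅x⁆∣≡1+∣p∣ {x = suc x} (false ∷ p) x∉p = ∣p∪⁅x⁆∣≡1+∣p∣ p (x∉p ∘ there)

x∉p-x : {x : Fin n} (p : Subset n) → x ∉ p - x
x∉p-x {x = zero} (b ∷ p) ()
x∉p-x {x = suc x} (b ∷ p) (there x∈p-x) = x∉p-x p x∈p-x

1+∣p-x∣≡∣p∣ : {x : Fin n} {p : Subset n} → x ∈ p → suc ∣ p - x ∣ ≡ ∣ p ∣
1+∣p-x∣≡∣p∣ {x = zero} {true ∷ p} here = cong (suc ∘ ∣_∣) (p─⊥≡p p)
1+∣p-x∣≡∣p∣ {x = suc x} {true ∷ p} (there x∈p) = cong suc (1+∣p-x∣≡∣p∣ x∈p)
1+∣p-x∣≡∣p∣ {x = suc x} {false ∷ p} (there x∈p) = 1+∣p-x∣≡∣p∣ x∈p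

0<∣p∣⇒Nonempty : {p : Subset n} → 0 < ∣ p ∣ → Nonempty p
0<∣p∣⇒Nonempty {n} {p} 0<∣p∣ with nonempty? p
... | yes nonempty = nonempty
... | no empty = contradiction (trans (cong ∣_∣ (Empty-unique empty)) (∣⊥∣≡0 n)) (>⇒≢ 0<∣p∣)

∃-⊆-of-size-∋ : ∀ m {x : Fin n} {p : Subset n} → x ∈ p → suc m ≤ ∣ p ∣ →
                Σ (Subset n) λ q → q ⊆ p × ∣ q ∣ ≡ suc m × x ∈ q
∃-⊆-of-size-∋ m {x} {p} x∈p m<∣p∣
  with q , q⊆p-x , ∣q∣≡m ← ∃-⊆-of-size m (p - x)
                              (≤-pred (subst (suc m ≤_) (sym (1+∣p-x∣≡∣p∣ x∈p)) m<∣p∣)) =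
  q ∪ ⁅ x ⁆ , q∪x⊆p ,
  trans (∣p∪⁅x⁆∣≡1+∣p∣ q (x∉p-x p ∘ q⊆p-x)) (cong suc ∣q∣≡m) ,
  x∈p∪q⁺ (inj₂ (x∈⁅x⁆ x))
  where
  q∪x⊆p : q ∪ ⁅ x ⁆ ⊆ p
  q∪x⊆p y∈ with x∈p∪q⁻ q ⁅ x ⁆ y∈
  ... | inj₁ y∈q = p─q⊆p p ⁅ x ⁆ (q⊆p-x y∈q)
  ... | inj₂ y∈⁅x⁆ rewrite x∈⁅y⁆⇒x≡y x y∈⁅x⁆ = x∈p

∃-∈-∉ : {p q : Subset n} → ¬ p ⊆ q → Σ (Fin n) λ x → x ∈ p × x ∉ q
∃-∈-∉ {n} {p} {q} p⊈q with x , x∈p↛x∈q ← ¬∀⟶∃¬ n _ (λ x → x ∈? p →-dec x ∈? q) (λ ∈→∈ → p⊈q (∈→∈ _)) =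
  x ,
  decidable-stable (x ∈? p) (λ x∉p → x∈p↛x∈q (λ x∈p → contradiction x∈p x∉p)) ,
  λ x∈q → x∈p↛x∈q (λ _ → x∈q)

∅ᶠ : Fam n
∅ᶠ _ = false

⊆ᶠ-refl : {𝒜 : Fam n} → 𝒜 ⊆ᶠ 𝒜
⊆ᶠ-refl _ X∈ = X∈

⊆ᶠ-trans : ∀ {𝒜 ℬ 𝒞 : Fam n} → 𝒜 ⊆ᶠ ℬ → ℬ ⊆ᶠ 𝒞 → 𝒜 ⊆ᶠ 𝒞
⊆ᶠ-trans 𝒜⊆ℬ ℬ⊆𝒞 X = ℬ⊆𝒞 X ∘ 𝒜⊆ℬ X

⊆ᶠ-antisym : {𝒜 ℬ : Fam n} → 𝒜 ⊆ᶠ ℬ → ℬ ⊆ᶠ 𝒜 → 𝒜 ≐ ℬ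
⊆ᶠ-antisym {𝒜 = 𝒜} {ℬ = ℬ} 𝒜⊆ℬ ℬ⊆𝒜 X with 𝒜 X in 𝒜X | ℬ X in ℬX
... | true | true = refl
... | false | false = refl
... | true | false = trans (sym (𝒜⊆ℬ X 𝒜X)) ℬX
... | false | true = trans (sym 𝒜X) (ℬ⊆𝒜 X ℬX)

∈ᶠ-∪⁻ : ∀ (𝒜 ℬ : Fam n) X → X ∈ᶠ (𝒜 ∪ᶠ ℬ) → X ∈ᶠ 𝒜 ⊎ X ∈ᶠ ℬ
∈ᶠ-∪⁻ 𝒜 ℬ X X∈ with 𝒜 X
... | true = inj₁ refl
... | false = inj₂ X∈

⊆ᶠ-∪ˡ : ∀ (𝒜 ℬ : Fam n) → 𝒜 ⊆ᶠ (𝒜 ∪ᶠ ℬ)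
⊆ᶠ-∪ˡ 𝒜 ℬ X X∈𝒜 rewrite X∈𝒜 = refl

⊆ᶠ-∪ʳ : ∀ (𝒜 ℬ : Fam n) → ℬ ⊆ᶠ (𝒜 ∪ᶠ ℬ)
⊆ᶠ-∪ʳ 𝒜 ℬ X X∈ℬ rewrite X∈ℬ = ∨-zeroʳ (𝒜 X)

∩ᶠ-⊆ˡ : ∀ (𝒜 ℬ : Fam n) → (𝒜 ∩ᶠ ℬ) ⊆ᶠ 𝒜
∩ᶠ-⊆ˡ 𝒜 ℬ X X∈ with 𝒜 X
... | true = refl

∩ᶠ-⊆ʳ : ∀ (𝒜 ℬ : Fam n) → (𝒜 ∩ᶠ ℬ) ⊆ᶠ ℬ
∩ᶠ-⊆ʳ 𝒜 ℬ X X∈ with 𝒜 X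
... | true = X∈

∖ᶠ-⊆ : ∀ (𝒜 : Fam n) C → (𝒜 ∖ᶠ C) ⊆ᶠ 𝒜
∖ᶠ-⊆ 𝒜 C X X∈ with 𝒜 X
... | true = refl

∈ᶠ-∖⇒≢ : ∀ (𝒜 : Fam n) C X → X ∈ᶠ (𝒜 ∖ᶠ C) → X ≢ C
∈ᶠ-∖⇒≢ 𝒜 C X X∈ X≡C with 𝒜 X | X ≟ˢ C
... | true | no X≢C = X≢C X≡C

∈ᶠ-∖⁺ : ∀ (𝒜 : Fam n) C X → X ∈ᶠ 𝒜 → X ≢ C → X ∈ᶠ (𝒜 ∖ᶠ C)
∈ᶠ-∖⁺ 𝒜 C X X∈𝒜 X≢C with X ≟ˢ C
... | yes X≡C = contradiction X≡C X≢C
... | no _ rewrite X∈𝒜 = refl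

∈ᶠ-⁅⁆⁻ : ∀ C (X : Subset n) → X ∈ᶠ ⁅ C ⁆ᶠ → X ≡ C
∈ᶠ-⁅⁆⁻ C X X∈ with X ≟ˢ C
... | yes X≡C = X≡C

∈ᶠ-⁅⁆⁺ : (C : Subset n) → C ∈ᶠ ⁅ C ⁆ᶠ
∈ᶠ-⁅⁆⁺ C with C ≟ˢ C
... | yes _ = refl
... | no C≢C = contradiction refl C≢C

_∈ᶠ?_ : (X : Subset n) (𝒜 : Fam n) → Dec (X ∈ᶠ 𝒜)
X ∈ᶠ? 𝒜 = 𝒜 X ≟ᵇ true

⊆ᶠ-∖ : ∀ {𝒜 ℬ : Fam n} C → 𝒜 ⊆ᶠ ℬ → C ∉ᶠ 𝒜 → 𝒜 ⊆ᶠ (ℬ ∖ᶠ C)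
⊆ᶠ-∖ {ℬ = ℬ} C 𝒜⊆ℬ C∉𝒜 X X∈𝒜 = ∈ᶠ-∖⁺ ℬ C X (𝒜⊆ℬ X X∈𝒜) λ { refl → C∉𝒜 X∈𝒜 }

∖ᶠ-mono : ∀ {𝒜 ℬ : Fam n} C → 𝒜 ⊆ᶠ ℬ → (𝒜 ∖ᶠ C) ⊆ᶠ (ℬ ∖ᶠ C)
∖ᶠ-mono {𝒜 = 𝒜} {ℬ} C 𝒜⊆ℬ X X∈ = ∈ᶠ-∖⁺ ℬ C X (𝒜⊆ℬ X (∖ᶠ-⊆ 𝒜 C X X∈)) (∈ᶠ-∖⇒≢ 𝒜 C X X∈)

∪ᶠ-mono : ∀ {𝒜 𝒜' ℬ ℬ' : Fam n} → 𝒜 ⊆ᶠ 𝒜' → ℬ ⊆ᶠ ℬ' → (𝒜 ∪ᶠ ℬ) ⊆ᶠ (𝒜' ∪ᶠ ℬ')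
∪ᶠ-mono {𝒜 = 𝒜} {𝒜'} {ℬ} {ℬ'} 𝒜⊆𝒜' ℬ⊆ℬ' X X∈ with ∈ᶠ-∪⁻ 𝒜 ℬ X X∈
... | inj₁ X∈𝒜 = ⊆ᶠ-∪ˡ 𝒜' ℬ' X (𝒜⊆𝒜' X X∈𝒜)
... | inj₂ X∈ℬ = ⊆ᶠ-∪ʳ 𝒜' ℬ' X (ℬ⊆ℬ' X X∈ℬ)

⊆ᶠ∪⁅C⁆⇒⊆ᶠ : ∀ {𝒜 ℬ : Fam n} C → 𝒜 ⊆ᶠ (ℬ ∪ᶠ ⁅ C ⁆ᶠ) → (∀ X → X ∈ᶠ 𝒜 → X ≢ C) → 𝒜 ⊆ᶠ ℬ
⊆ᶠ∪⁅C⁆⇒⊆ᶠ {ℬ = ℬ} C 𝒜⊆ℬ∪C ≢C X X∈𝒜 with ∈ᶠ-∪⁻ ℬ ⁅ C ⁆ᶠ X (𝒜⊆ℬ∪C X X∈𝒜)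
... | inj₁ X∈ℬ = X∈ℬ
... | inj₂ X∈⁅C⁆ = contradiction (∈ᶠ-⁅⁆⁻ C X X∈⁅C⁆) (≢C X X∈𝒜)

∪ᶠ-⊆ : ∀ {𝒜 ℬ 𝒞 : Fam n} → 𝒜 ⊆ᶠ 𝒞 → ℬ ⊆ᶠ 𝒞 → (𝒜 ∪ᶠ ℬ) ⊆ᶠ 𝒞
∪ᶠ-⊆ {𝒜 = 𝒜} {ℬ} 𝒜⊆𝒞 ℬ⊆𝒞 X X∈ with ∈ᶠ-∪⁻ 𝒜 ℬ X X∈
... | inj₁ X∈𝒜 = 𝒜⊆𝒞 X X∈𝒜
... | inj₂ X∈ℬ = ℬ⊆𝒞 X X∈ℬ

⁅⁆ᶠ-⊆ : ∀ {𝒜 : Fam n} {C} → C ∈ᶠ 𝒜 → ⁅ C ⁆ᶠ ⊆ᶠ 𝒜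
⁅⁆ᶠ-⊆ {𝒜 = 𝒜} {C} C∈𝒜 X X∈⁅C⁆ = subst (_∈ᶠ 𝒜) (sym (∈ᶠ-⁅⁆⁻ C X X∈⁅C⁆)) C∈𝒜

∩ᶠ-mono : ∀ {𝒜 𝒜' ℬ ℬ' : Fam n} → 𝒜 ⊆ᶠ 𝒜' → ℬ ⊆ᶠ ℬ' → (𝒜 ∩ᶠ ℬ) ⊆ᶠ (𝒜' ∩ᶠ ℬ')
∩ᶠ-mono {𝒜 = 𝒜} {ℬ = ℬ} 𝒜⊆𝒜' ℬ⊆ℬ' X X∈ = cong₂ _∧_ (𝒜⊆𝒜' X (∩ᶠ-⊆ˡ 𝒜 ℬ X X∈)) (ℬ⊆ℬ' X (∩ᶠ-⊆ʳ 𝒜 ℬ X X∈))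

count : List (Subset n) → Fam n → ℕ
count L 𝒜 = sum (map (λ X → if 𝒜 X then 1 else 0) L)

count-cong : {𝒜 ℬ : Fam n} (L : List (Subset n)) → 𝒜 ≐ ℬ → count L 𝒜 ≡ count L ℬ
count-cong [] _ = refl
count-cong (X ∷ L) 𝒜≐ℬ = cong₂ _+_ (cong (if_then 1 else 0) (𝒜≐ℬ X)) (count-cong L 𝒜≐ℬ)

count-mono : {𝒜 ℬ : Fam n} (L : List (Subset n)) → 𝒜 ⊆ᶠ ℬ → count L 𝒜 ≤ count L ℬ
count-mono [] _ = z≤n
count-mono {𝒜 = 𝒜} {ℬ = ℬ} (X ∷ L) 𝒜⊆ℬ with 𝒜 X in 𝒜X
... | true rewrite 𝒜⊆ℬ X 𝒜X = s≤s (count-mono L 𝒜⊆ℬ)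
... | false = ≤-trans (count-mono L 𝒜⊆ℬ) (m≤n+m _ _)

count-∪+∩ : (L : List (Subset n)) (𝒜 ℬ : Fam n) →
            count L (𝒜 ∪ᶠ ℬ) + count L (𝒜 ∩ᶠ ℬ) ≡ count L 𝒜 + count L ℬ
count-∪+∩ [] _ _ = refl
count-∪+∩ (X ∷ L) 𝒜 ℬ with 𝒜 X | ℬ X
... | true | true =
  cong suc (trans (+-suc _ _) (trans (cong suc (count-∪+∩ L 𝒜 ℬ)) (sym (+-suc _ _))))
... | true | false = cong suc (count-∪+∩ L 𝒜 ℬ)
... | false | true = trans (cong suc (count-∪+∩ L 𝒜 ℬ)) (sym (+-suc _ _))
... | false | false = count-∪+∩ L 𝒜 ℬ

count-∅ : (L : List (Subset n)) → count L ∅ᶠ ≡ 0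
count-∅ [] = refl
count-∅ (_ ∷ L) = count-∅ L

count>0⇒nonempty : {𝒜 : Fam n} (L : List (Subset n)) → 0 < count L 𝒜 → Σ (Subset n) (_∈ᶠ 𝒜)
count>0⇒nonempty {𝒜 = 𝒜} (X ∷ L) 0<count with 𝒜 X in X∈𝒜
... | true = X , X∈𝒜
... | false = count>0⇒nonempty L 0<count

∣∅ᶠ∣ᶠ≡0 : ∀ n → ∣ ∅ᶠ {n} ∣ᶠ ≡ 0
∣∅ᶠ∣ᶠ≡0 n = count-∅ (allSubsets n)

∣_∣ᶠ-mono : (𝒜 ℬ : Fam n) → 𝒜 ⊆ᶠ ℬ → ∣ 𝒜 ∣ᶠ ≤ ∣ ℬ ∣ᶠ
∣_∣ᶠ-mono {n} _ _ = count-mono (allSubsets n)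

∣𝒜∣ᶠ≡∣𝒜∘[b∷]∣ᶠ+∣𝒜∘[¬b∷]∣ᶠ : (b : Bool) (𝒜 : Fam (suc n)) →
                             ∣ 𝒜 ∣ᶠ ≡ ∣ 𝒜 ∘ (b ∷_) ∣ᶠ + ∣ 𝒜 ∘ (not b ∷_) ∣ᶠ
∣𝒜∣ᶠ≡∣𝒜∘[b∷]∣ᶠ+∣𝒜∘[¬b∷]∣ᶠ {n} true 𝒜 = begin
  sum (map f (map (true ∷_) L ++ map (false ∷_) L))
    ≡⟨ cong sum (map-++ f (map (true ∷_) L) _) ⟩
  sum (map f (map (true ∷_) L) ++ map f (map (false ∷_) L))
    ≡⟨ sum-++ (map f (map (true ∷_) L)) _ ⟩
  sum (map f (map (true ∷_) L)) + sum (map f (map (false ∷_) L))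
    ≡⟨ cong₂ (λ t u → sum t + sum u) (map-∘ L) (map-∘ L) ⟨
  ∣ 𝒜 ∘ (true ∷_) ∣ᶠ + ∣ 𝒜 ∘ (false ∷_) ∣ᶠ ∎
  where
  open ≡-Reasoning
  L = allSubsets n
  f = λ X → if 𝒜 X then 1 else 0
∣𝒜∣ᶠ≡∣𝒜∘[b∷]∣ᶠ+∣𝒜∘[¬b∷]∣ᶠ false 𝒜 =
  trans (∣𝒜∣ᶠ≡∣𝒜∘[b∷]∣ᶠ+∣𝒜∘[¬b∷]∣ᶠ true 𝒜) (+-comm ∣ 𝒜 ∘ (true ∷_) ∣ᶠ ∣ 𝒜 ∘ (false ∷_) ∣ᶠ)

⁅b∷C⁆ᶠ∘[b∷]≐⁅C⁆ᶠ : (b : Bool) (C : Subset n) → (⁅ b ∷ C ⁆ᶠ ∘ (b ∷_)) ≐ ⁅ C ⁆ᶠ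
⁅b∷C⁆ᶠ∘[b∷]≐⁅C⁆ᶠ b C = ⊆ᶠ-antisym
  (λ X bX∈ → subst (_∈ᶠ ⁅ C ⁆ᶠ) (sym (∷-injectiveʳ (∈ᶠ-⁅⁆⁻ (b ∷ C) (b ∷ X) bX∈))) (∈ᶠ-⁅⁆⁺ C))
  (λ X X∈ → subst (λ Y → (b ∷ Y) ∈ᶠ ⁅ b ∷ C ⁆ᶠ) (sym (∈ᶠ-⁅⁆⁻ C X X∈)) (∈ᶠ-⁅⁆⁺ (b ∷ C)))

⁅b∷C⁆ᶠ∘[¬b∷]≐∅ᶠ : (b : Bool) (C : Subset n) → (⁅ b ∷ C ⁆ᶠ ∘ (not b ∷_)) ≐ ∅ᶠ
⁅b∷C⁆ᶠ∘[¬b∷]≐∅ᶠ b C = ⊆ᶠ-antisym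
  (λ X ¬bX∈ → contradiction (sym (∷-injectiveˡ (∈ᶠ-⁅⁆⁻ (b ∷ C) (not b ∷ X) ¬bX∈))) (not-¬ refl))
  (λ _ ())

∣⁅C⁆ᶠ∣ᶠ≡1 : (C : Subset n) → ∣ ⁅ C ⁆ᶠ ∣ᶠ ≡ 1
∣⁅C⁆ᶠ∣ᶠ≡1 [] = refl
∣⁅C⁆ᶠ∣ᶠ≡1 {suc n} (b ∷ C) = begin
  ∣ ⁅ b ∷ C ⁆ᶠ ∣ᶠ
    ≡⟨ ∣𝒜∣ᶠ≡∣𝒜∘[b∷]∣ᶠ+∣𝒜∘[¬b∷]∣ᶠ b ⁅ b ∷ C ⁆ᶠ ⟩
  ∣ ⁅ b ∷ C ⁆ᶠ ∘ (b ∷_) ∣ᶠ + ∣ ⁅ b ∷ C ⁆ᶠ ∘ (not b ∷_) ∣ᶠ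
    ≡⟨ cong₂ _+_ (count-cong L (⁅b∷C⁆ᶠ∘[b∷]≐⁅C⁆ᶠ b C)) (count-cong L (⁅b∷C⁆ᶠ∘[¬b∷]≐∅ᶠ b C)) ⟩
  ∣ ⁅ C ⁆ᶠ ∣ᶠ + ∣ ∅ᶠ {n} ∣ᶠ
    ≡⟨ cong₂ _+_ (∣⁅C⁆ᶠ∣ᶠ≡1 C) (∣∅ᶠ∣ᶠ≡0 n) ⟩
  1 ∎
  where
  open ≡-Reasoning
  L = allSubsets n

∣𝒜∪ℬ∣ᶠ≡∣𝒜∣ᶠ+∣ℬ∣ᶠ : (𝒜 ℬ : Fam n) → (∀ X → X ∈ᶠ 𝒜 → X ∉ᶠ ℬ) → ∣ 𝒜 ∪ᶠ ℬ ∣ᶠ ≡ ∣ 𝒜 ∣ᶠ + ∣ ℬ ∣ᶠ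
∣𝒜∪ℬ∣ᶠ≡∣𝒜∣ᶠ+∣ℬ∣ᶠ {n} 𝒜 ℬ disjoint = begin
  ∣ 𝒜 ∪ᶠ ℬ ∣ᶠ                  ≡⟨ +-identityʳ _ ⟨
  ∣ 𝒜 ∪ᶠ ℬ ∣ᶠ + 0              ≡⟨ cong (∣ 𝒜 ∪ᶠ ℬ ∣ᶠ +_) ∣𝒜∩ℬ∣≡0 ⟨
  ∣ 𝒜 ∪ᶠ ℬ ∣ᶠ + ∣ 𝒜 ∩ᶠ ℬ ∣ᶠ    ≡⟨ count-∪+∩ (allSubsets n) 𝒜 ℬ ⟩
  ∣ 𝒜 ∣ᶠ + ∣ ℬ ∣ᶠ ∎
  where
  open ≡-Reasoning
  𝒜∩ℬ≐∅ : (𝒜 ∩ᶠ ℬ) ≐ ∅ᶠ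
  𝒜∩ℬ≐∅ = ⊆ᶠ-antisym (λ X X∈ → contradiction (∩ᶠ-⊆ʳ 𝒜 ℬ X X∈) (disjoint X (∩ᶠ-⊆ˡ 𝒜 ℬ X X∈))) (λ _ ())
  ∣𝒜∩ℬ∣≡0 : ∣ 𝒜 ∩ᶠ ℬ ∣ᶠ ≡ 0
  ∣𝒜∩ℬ∣≡0 = trans (count-cong (allSubsets n) 𝒜∩ℬ≐∅) (∣∅ᶠ∣ᶠ≡0 n)

∣𝒜∪⁅C⁆ᶠ∣ᶠ≡1+∣𝒜∣ᶠ : (𝒜 : Fam n) (C : Subset n) → C ∉ᶠ 𝒜 → ∣ 𝒜 ∪ᶠ ⁅ C ⁆ᶠ ∣ᶠ ≡ suc ∣ 𝒜 ∣ᶠ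
∣𝒜∪⁅C⁆ᶠ∣ᶠ≡1+∣𝒜∣ᶠ 𝒜 C C∉𝒜 = begin
  ∣ 𝒜 ∪ᶠ ⁅ C ⁆ᶠ ∣ᶠ
    ≡⟨ ∣𝒜∪ℬ∣ᶠ≡∣𝒜∣ᶠ+∣ℬ∣ᶠ 𝒜 ⁅ C ⁆ᶠ (λ X X∈𝒜 X∈⁅C⁆ → C∉𝒜 (subst (_∈ᶠ 𝒜) (∈ᶠ-⁅⁆⁻ C X X∈⁅C⁆) X∈𝒜)) ⟩
  ∣ 𝒜 ∣ᶠ + ∣ ⁅ C ⁆ᶠ ∣ᶠ      ≡⟨ cong (∣ 𝒜 ∣ᶠ +_) (∣⁅C⁆ᶠ∣ᶠ≡1 C) ⟩
  ∣ 𝒜 ∣ᶠ + 1               ≡⟨ +-comm _ 1 ⟩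
  suc ∣ 𝒜 ∣ᶠ ∎
  where open ≡-Reasoning

∣𝒜∣ᶠ≡1+∣𝒜∖C∣ᶠ : (𝒜 : Fam n) (C : Subset n) → C ∈ᶠ 𝒜 → ∣ 𝒜 ∣ᶠ ≡ suc ∣ 𝒜 ∖ᶠ C ∣ᶠ
∣𝒜∣ᶠ≡1+∣𝒜∖C∣ᶠ {n} 𝒜 C C∈𝒜 = trans (count-cong (allSubsets n) 𝒜≐𝒜∖C∪C) (∣𝒜∪⁅C⁆ᶠ∣ᶠ≡1+∣𝒜∣ᶠ (𝒜 ∖ᶠ C) C C∉𝒜∖C)
  where
  C∉𝒜∖C : C ∉ᶠ (𝒜 ∖ᶠ C)
  C∉𝒜∖C C∈ = ∈ᶠ-∖⇒≢ 𝒜 C C C∈ refl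
  𝒜≐𝒜∖C∪C : 𝒜 ≐ ((𝒜 ∖ᶠ C) ∪ᶠ ⁅ C ⁆ᶠ)
  𝒜≐𝒜∖C∪C = ⊆ᶠ-antisym
    (λ X X∈𝒜 → case X ≟ˢ C of λ where
      (yes refl) → ⊆ᶠ-∪ʳ (𝒜 ∖ᶠ C) ⁅ C ⁆ᶠ C (∈ᶠ-⁅⁆⁺ C)
      (no X≢C) → ⊆ᶠ-∪ˡ (𝒜 ∖ᶠ C) ⁅ C ⁆ᶠ X (∈ᶠ-∖⁺ 𝒜 C X X∈𝒜 X≢C))
    (λ X X∈ → case ∈ᶠ-∪⁻ (𝒜 ∖ᶠ C) ⁅ C ⁆ᶠ X X∈ of λ where
      (inj₁ X∈𝒜∖C) → ∖ᶠ-⊆ 𝒜 C X X∈𝒜∖C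
      (inj₂ X∈⁅C⁆) → subst (_∈ᶠ 𝒜) (sym (∈ᶠ-⁅⁆⁻ C X X∈⁅C⁆)) C∈𝒜)

∈-allSubsets : (X : Subset n) → X ∈ₗ allSubsets n
∈-allSubsets [] = here refl
∈-allSubsets {suc n} (true ∷ X) = ∈-++⁺ˡ (∈-map⁺ (true ∷_) (∈-allSubsets X))
∈-allSubsets {suc n} (false ∷ X) =
  ∈-++⁺ʳ (map (true ∷_) (allSubsets n)) (∈-map⁺ (false ∷_) (∈-allSubsets X))

⋃ᶠ : Fam n → Subset n
⋃ᶠ 𝒜 = ∁ (⋂∁ 𝒜)

private
  ⋂∁-over : List (Subset n) → Fam n → Subset n
  ⋂∁-over L 𝒜 = foldr (λ X acc → if 𝒜 X then ∁ X ∩ acc else acc) ⊤ L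

  ∈⋂∁-over⇒∉ : ∀ (L : List (Subset n)) 𝒜 {X} {x} → X ∈ₗ L → X ∈ᶠ 𝒜 → x ∈ X → x ∉ ⋂∁-over L 𝒜
  ∈⋂∁-over⇒∉ (Y ∷ L) 𝒜 (here refl) Y∈𝒜 x∈Y x∈⋂ rewrite Y∈𝒜 =
    x∈p⇒x∉∁p x∈Y (proj₁ (x∈p∩q⁻ (∁ Y) (⋂∁-over L 𝒜) x∈⋂))
  ∈⋂∁-over⇒∉ (Y ∷ L) 𝒜 (there X∈L) X∈𝒜 x∈X x∈⋂ with 𝒜 Y
  ... | true = ∈⋂∁-over⇒∉ L 𝒜 X∈L X∈𝒜 x∈X (proj₂ (x∈p∩q⁻ (∁ Y) (⋂∁-over L 𝒜) x∈⋂))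
  ... | false = ∈⋂∁-over⇒∉ L 𝒜 X∈L X∈𝒜 x∈X x∈⋂

  ∉⋂∁-over⇒∈ : ∀ (L : List (Subset n)) 𝒜 {x} → x ∉ ⋂∁-over L 𝒜 → Σ (Subset n) λ X → X ∈ᶠ 𝒜 × x ∈ X
  ∉⋂∁-over⇒∈ [] 𝒜 x∉⊤ = contradiction ∈⊤ x∉⊤
  ∉⋂∁-over⇒∈ (Y ∷ L) 𝒜 {x} x∉⋂ with 𝒜 Y in Y∈𝒜 | x ∈? Y
  ... | false | _ = ∉⋂∁-over⇒∈ L 𝒜 x∉⋂
  ... | true | yes x∈Y = Y , Y∈𝒜 , x∈Y
  ... | true | no x∉Y = ∉⋂∁-over⇒∈ L 𝒜 (x∉⋂ ∘ x∈p∩q⁺ ∘ (x∉p⇒x∈∁p x∉Y ,_))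

⊆⋃ᶠ : ∀ (𝒜 : Fam n) X → X ∈ᶠ 𝒜 → X ⊆ ⋃ᶠ 𝒜
⊆⋃ᶠ {n} 𝒜 X X∈𝒜 x∈X = x∉p⇒x∈∁p (∈⋂∁-over⇒∉ (allSubsets n) 𝒜 (∈-allSubsets X) X∈𝒜 x∈X)

∈⋃ᶠ⁻ : ∀ (𝒜 : Fam n) {x} → x ∈ ⋃ᶠ 𝒜 → Σ (Subset n) λ X → X ∈ᶠ 𝒜 × x ∈ X
∈⋃ᶠ⁻ {n} 𝒜 x∈⋃ = ∉⋂∁-over⇒∈ (allSubsets n) 𝒜 (x∈∁p⇒x∉p x∈⋃)

⋃ᶠ-least : ∀ (𝒜 : Fam n) {Y} → (∀ X → X ∈ᶠ 𝒜 → X ⊆ Y) → ⋃ᶠ 𝒜 ⊆ Y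
⋃ᶠ-least 𝒜 members⊆Y x∈⋃ with X , X∈𝒜 , x∈X ← ∈⋃ᶠ⁻ 𝒜 x∈⋃ = members⊆Y X X∈𝒜 x∈X

⋃ᶠ-mono : ∀ (𝒜 ℬ : Fam n) → 𝒜 ⊆ᶠ ℬ → ⋃ᶠ 𝒜 ⊆ ⋃ᶠ ℬ
⋃ᶠ-mono 𝒜 ℬ 𝒜⊆ℬ = ⋃ᶠ-least 𝒜 (λ X X∈𝒜 → ⊆⋃ᶠ ℬ X (𝒜⊆ℬ X X∈𝒜))

∣⋃ᶠ∣-submodular : ∀ (𝒜 ℬ : Fam n) → ∣ ⋃ᶠ (𝒜 ∪ᶠ ℬ) ∣ + ∣ ⋃ᶠ (𝒜 ∩ᶠ ℬ) ∣ ≤ ∣ ⋃ᶠ 𝒜 ∣ + ∣ ⋃ᶠ ℬ ∣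
∣⋃ᶠ∣-submodular 𝒜 ℬ = begin
  ∣ ⋃ᶠ (𝒜 ∪ᶠ ℬ) ∣ + ∣ ⋃ᶠ (𝒜 ∩ᶠ ℬ) ∣   ≤⟨ +-mono-≤ (p⊆q⇒∣p∣≤∣q∣ ⋃∪⊆) (p⊆q⇒∣p∣≤∣q∣ ⋃∩⊆) ⟩
  ∣ ⋃ᶠ 𝒜 ∪ ⋃ᶠ ℬ ∣ + ∣ ⋃ᶠ 𝒜 ∩ ⋃ᶠ ℬ ∣   ≡⟨ ∣p∪q∣+∣p∩q∣≡∣p∣+∣q∣ (⋃ᶠ 𝒜) (⋃ᶠ ℬ) ⟩
  ∣ ⋃ᶠ 𝒜 ∣ + ∣ ⋃ᶠ ℬ ∣ ∎
  where
  open ≤-Reasoning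
  ⋃∪⊆ : ⋃ᶠ (𝒜 ∪ᶠ ℬ) ⊆ ⋃ᶠ 𝒜 ∪ ⋃ᶠ ℬ
  ⋃∪⊆ = ⋃ᶠ-least (𝒜 ∪ᶠ ℬ) λ X X∈ → case ∈ᶠ-∪⁻ 𝒜 ℬ X X∈ of λ where
    (inj₁ X∈𝒜) → ⊆-trans (⊆⋃ᶠ 𝒜 X X∈𝒜) (p⊆p∪q _)
    (inj₂ X∈ℬ) → ⊆-trans (⊆⋃ᶠ ℬ X X∈ℬ) (q⊆p∪q _ _)
  ⋃∩⊆ : ⋃ᶠ (𝒜 ∩ᶠ ℬ) ⊆ ⋃ᶠ 𝒜 ∩ ⋃ᶠ ℬ
  ⋃∩⊆ = ⋃ᶠ-least (𝒜 ∩ᶠ ℬ) λ X X∈ x∈X →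
    x∈p∩q⁺ (⊆⋃ᶠ 𝒜 X (∩ᶠ-⊆ˡ 𝒜 ℬ X X∈) x∈X , ⊆⋃ᶠ ℬ X (∩ᶠ-⊆ʳ 𝒜 ℬ X X∈) x∈X)

module DerivedMatroid {n : ℕ} (rk : Subset n → ℕ) where

  bound : Fam n → ℕ
  bound 𝒜 = (n ∸ rankM rk) ∸ dualRank rk (⋂∁ 𝒜)

  Overfull : Fam n → Set
  Overfull 𝒜 = bound 𝒜 < ∣ 𝒜 ∣ᶠ

  HasOverfull : Fam n → Set
  HasOverfull 𝒜 = Σ (Fam n) λ 𝒜' → 𝒜' ⊆ᶠ 𝒜 × Overfull 𝒜'

  Sparse : Fam n → Set
  Sparse ℐ = ∀ 𝒜 → 𝒜 ⊆ᶠ ℐ → ∣ 𝒜 ∣ᶠ ≤ bound 𝒜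

  Sparse⇒¬HasOverfull : ∀ {ℐ} → Sparse ℐ → ¬ HasOverfull ℐ
  Sparse⇒¬HasOverfull sparse (𝒜 , 𝒜⊆ℐ , overfull) = <⇒≱ overfull (sparse 𝒜 𝒜⊆ℐ)

  ¬HasOverfull⇒Sparse : ∀ {ℐ} → ¬ HasOverfull ℐ → Sparse ℐ
  ¬HasOverfull⇒Sparse ¬overfull 𝒜 𝒜⊆ℐ with ∣ 𝒜 ∣ᶠ ≤? bound 𝒜
  ... | yes ∣𝒜∣≤bound = ∣𝒜∣≤bound
  ... | no ∣𝒜∣≰bound = contradiction (𝒜 , 𝒜⊆ℐ , ≰⇒> ∣𝒜∣≰bound) ¬overfull

  HasOverfull-mono : ∀ {𝒜 ℬ} → 𝒜 ⊆ᶠ ℬ → HasOverfull 𝒜 → HasOverfull ℬ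
  HasOverfull-mono 𝒜⊆ℬ (𝒜' , 𝒜'⊆𝒜 , overfull) = 𝒜' , ⊆ᶠ-trans 𝒜'⊆𝒜 𝒜⊆ℬ , overfull

  notS⇒Overfull : ∀ {𝒜} → notS rk 𝒜 → Overfull 𝒜
  notS⇒Overfull (oc , ¬S) = ≰⇒> (λ ∣𝒜∣≤bound → ¬S (oc , ∣𝒜∣≤bound))

  Overfull⇒notS : ∀ {𝒜} → OfCircuits rk 𝒜 → Overfull 𝒜 → notS rk 𝒜
  Overfull⇒notS oc overfull = oc , λ (_ , ∣𝒜∣≤bound) → <⇒≱ overfull ∣𝒜∣≤bound

  OfCircuits-⊆ : ∀ {𝒜 ℬ} → 𝒜 ⊆ᶠ ℬ → OfCircuits rk ℬ → OfCircuits rk 𝒜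
  OfCircuits-⊆ 𝒜⊆ℬ oc C C∈ = oc C (𝒜⊆ℬ C C∈)

  OfCircuits-∪⁅⁆ : ∀ {𝒜 C} → OfCircuits rk 𝒜 → IsCircuit rk C → OfCircuits rk (𝒜 ∪ᶠ ⁅ C ⁆ᶠ)
  OfCircuits-∪⁅⁆ {𝒜} {C} oc circuit X X∈ with ∈ᶠ-∪⁻ 𝒜 ⁅ C ⁆ᶠ X X∈
  ... | inj₁ X∈𝒜 = oc X X∈𝒜
  ... | inj₂ X∈⁅C⁆ = subst (IsCircuit rk) (sym (∈ᶠ-⁅⁆⁻ C X X∈⁅C⁆)) circuit

  stage⇒OfCircuits : ∀ i {𝒜} → stage rk (notS rk) i 𝒜 → OfCircuits rk 𝒜
  stage⇒OfCircuits zero = proj₁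
  stage⇒OfCircuits (suc i) = proj₁

  HasOverfull⇒stage : ∀ j {𝒜} → OfCircuits rk 𝒜 → HasOverfull 𝒜 → stage rk (notS rk) (suc j) 𝒜
  HasOverfull⇒stage zero oc (𝒜' , 𝒜'⊆𝒜 , overfull) =
    oc , 𝒜' , inj₁ (Overfull⇒notS (OfCircuits-⊆ 𝒜'⊆𝒜 oc) overfull) , 𝒜'⊆𝒜
  HasOverfull⇒stage (suc j) {𝒜} oc hasOverfull =
    oc , 𝒜 , inj₁ (HasOverfull⇒stage j oc hasOverfull) , ⊆ᶠ-refl

  HasOverfull⇒DependentDM : ∀ {𝒜} → OfCircuits rk 𝒜 → HasOverfull 𝒜 → DependentDM rk 𝒜
  HasOverfull⇒DependentDM oc hasOverfull = 1 , HasOverfull⇒stage 0 oc hasOverfull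

  IndependentDM⇒Sparse : ∀ {ℐ} → IndependentDM rk ℐ → Sparse ℐ
  IndependentDM⇒Sparse (oc , independent) =
    ¬HasOverfull⇒Sparse (independent ∘ HasOverfull⇒DependentDM oc)

  OverfullElimination : Set
  OverfullElimination = ∀ {𝒜₁ 𝒜₂ C} → IsCircuit rk C → C ∈ᶠ 𝒜₁ → C ∈ᶠ 𝒜₂ →
    Overfull 𝒜₁ → Overfull 𝒜₂ → ¬ Overfull (𝒜₁ ∩ᶠ 𝒜₂) → Overfull ((𝒜₁ ∪ᶠ 𝒜₂) ∖ᶠ C)

  module WithOverfullElimination (eliminate : OverfullElimination) where

    HasOverfull-∪∖ : ∀ {𝒜₁ 𝒜₂ 𝒜₁' 𝒜₂' C} → IsCircuit rk C → 𝒜₁' ⊆ᶠ 𝒜₁ → 𝒜₂' ⊆ᶠ 𝒜₂ →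
      Overfull 𝒜₁' → Overfull 𝒜₂' → ¬ Overfull (𝒜₁' ∩ᶠ 𝒜₂') → HasOverfull ((𝒜₁ ∪ᶠ 𝒜₂) ∖ᶠ C)
    HasOverfull-∪∖ {𝒜₁} {𝒜₂} {𝒜₁'} {𝒜₂'} {C} circuit 𝒜₁'⊆𝒜₁ 𝒜₂'⊆𝒜₂ overfull₁ overfull₂ ¬overfull₁₂
      with C ∈ᶠ? 𝒜₁' | C ∈ᶠ? 𝒜₂'
    ... | no C∉𝒜₁' | _ = 𝒜₁' , ⊆ᶠ-∖ C (⊆ᶠ-trans 𝒜₁'⊆𝒜₁ (⊆ᶠ-∪ˡ 𝒜₁ 𝒜₂)) C∉𝒜₁' , overfull₁
    ... | yes _ | no C∉𝒜₂' = 𝒜₂' , ⊆ᶠ-∖ C (⊆ᶠ-trans 𝒜₂'⊆𝒜₂ (⊆ᶠ-∪ʳ 𝒜₁ 𝒜₂)) C∉𝒜₂' , overfull₂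
    ... | yes C∈𝒜₁' | yes C∈𝒜₂' =
      (𝒜₁' ∪ᶠ 𝒜₂') ∖ᶠ C , ∖ᶠ-mono C (∪ᶠ-mono 𝒜₁'⊆𝒜₁ 𝒜₂'⊆𝒜₂) ,
      eliminate circuit C∈𝒜₁' C∈𝒜₂' overfull₁ overfull₂ ¬overfull₁₂

    mutual
      stage⇒HasOverfull : ∀ i {𝒜} → stage rk (notS rk) i 𝒜 → HasOverfull 𝒜
      stage⇒HasOverfull zero s = _ , ⊆ᶠ-refl , notS⇒Overfull s
      stage⇒HasOverfull (suc i) (_ , ℬ , ℬ∈ε , ℬ⊆𝒜) = HasOverfull-mono ℬ⊆𝒜 (ε-stage⇒HasOverfull i ℬ∈ε)

      ε-stage⇒HasOverfull : ∀ i {ℬ} → ε rk (stage rk (notS rk) i) ℬ → HasOverfull ℬ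
      ε-stage⇒HasOverfull i (inj₁ s) = stage⇒HasOverfull i s
      ε-stage⇒HasOverfull i (inj₂ (𝒜₁ , 𝒜₂ , C , s₁ , s₂ , ¬s₁₂ , C∈𝒜₁ , _ , ℬ≐)) =
        HasOverfull-mono {(𝒜₁ ∪ᶠ 𝒜₂) ∖ᶠ C} (λ X X∈ → trans (ℬ≐ X) X∈)
          (stage-elimination i s₁ s₂ ¬s₁₂ (stage⇒OfCircuits i s₁ C C∈𝒜₁))

      stage-elimination : ∀ i {𝒜₁ 𝒜₂ C} → stage rk (notS rk) i 𝒜₁ → stage rk (notS rk) i 𝒜₂ →
        ¬ stage rk (notS rk) i (𝒜₁ ∩ᶠ 𝒜₂) → IsCircuit rk C → HasOverfull ((𝒜₁ ∪ᶠ 𝒜₂) ∖ᶠ C)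
      stage-elimination zero s₁ s₂ ¬s₁₂ circuit =
        HasOverfull-∪∖ circuit ⊆ᶠ-refl ⊆ᶠ-refl (notS⇒Overfull s₁) (notS⇒Overfull s₂)
          (¬s₁₂ ∘ Overfull⇒notS (OfCircuits-⊆ (∩ᶠ-⊆ˡ _ _) (proj₁ s₁)))
      stage-elimination (suc i) {𝒜₁} {𝒜₂} s₁ s₂ ¬s₁₂ circuit
        with 𝒜₁' , 𝒜₁'⊆𝒜₁ , overfull₁ ← stage⇒HasOverfull (suc i) s₁
           | 𝒜₂' , 𝒜₂'⊆𝒜₂ , overfull₂ ← stage⇒HasOverfull (suc i) s₂ =
        HasOverfull-∪∖ circuit 𝒜₁'⊆𝒜₁ 𝒜₂'⊆𝒜₂ overfull₁ overfull₂ λ overfull₁₂ →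
          ¬s₁₂ (HasOverfull⇒stage i (OfCircuits-⊆ (∩ᶠ-⊆ˡ 𝒜₁ 𝒜₂) (proj₁ s₁))
                 (𝒜₁' ∩ᶠ 𝒜₂' , ∩ᶠ-mono 𝒜₁'⊆𝒜₁ 𝒜₂'⊆𝒜₂ , overfull₁₂))

    DependentDM⇒HasOverfull : ∀ {𝒜} → DependentDM rk 𝒜 → HasOverfull 𝒜
    DependentDM⇒HasOverfull (i , s) = stage⇒HasOverfull i s

    Sparse⇒IndependentDM : ∀ {ℐ} → OfCircuits rk ℐ → Sparse ℐ → IndependentDM rk ℐ
    Sparse⇒IndependentDM oc sparse = oc , Sparse⇒¬HasOverfull sparse ∘ DependentDM⇒HasOverfull

  RankDMIs-cong : ∀ {𝒳 𝒴 r} → 𝒳 ≐ 𝒴 → RankDMIs rk 𝒳 r → RankDMIs rk 𝒴 r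
  RankDMIs-cong 𝒳≐𝒴 ((ℐ , ℐ⊆𝒳 , independent , ∣ℐ∣≡r) , maximal) =
    (ℐ , (λ X X∈ → trans (sym (𝒳≐𝒴 X)) (ℐ⊆𝒳 X X∈)) , independent , ∣ℐ∣≡r) ,
    λ 𝒥 𝒥⊆𝒴 → maximal 𝒥 (λ X X∈ → trans (𝒳≐𝒴 X) (𝒥⊆𝒴 X X∈))

  InClDM-cong : ∀ {𝒳 𝒴 C} → 𝒳 ≐ 𝒴 → InClDM rk 𝒳 C → InClDM rk 𝒴 C
  InClDM-cong {C = C} 𝒳≐𝒴 (circuit , r , rank𝒳 , rank𝒳∪C) =
    circuit , r , RankDMIs-cong 𝒳≐𝒴 rank𝒳 ,
    RankDMIs-cong (λ X → cong (_∨ ⁅ C ⁆ᶠ X) (𝒳≐𝒴 X)) rank𝒳∪C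

  IsClDM-cong : ∀ {𝒳 𝒴 𝒴'} → 𝒴 ≐ 𝒴' → IsClDM rk 𝒳 𝒴 → IsClDM rk 𝒳 𝒴'
  IsClDM-cong 𝒴≐𝒴' (oc , cl) = oc , λ C circuit →
    mk⇔ (InClDM-cong 𝒴≐𝒴' ∘ Equivalence.to (cl C circuit))
        (Equivalence.from (cl C circuit) ∘ InClDM-cong (sym ∘ 𝒴≐𝒴'))

  ∈⇒InClDM : ∀ {𝒳 C r} → IsCircuit rk C → C ∈ᶠ 𝒳 → RankDMIs rk 𝒳 r → InClDM rk 𝒳 C
  ∈⇒InClDM {𝒳} {C} circuit C∈𝒳 rank𝒳 =
    circuit , _ , rank𝒳 , RankDMIs-cong (⊆ᶠ-antisym (⊆ᶠ-∪ˡ 𝒳 ⁅ C ⁆ᶠ) 𝒳∪C⊆𝒳) rank𝒳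
    where
    𝒳∪C⊆𝒳 : (𝒳 ∪ᶠ ⁅ C ⁆ᶠ) ⊆ᶠ 𝒳
    𝒳∪C⊆𝒳 X X∈ with ∈ᶠ-∪⁻ 𝒳 ⁅ C ⁆ᶠ X X∈
    ... | inj₁ X∈𝒳 = X∈𝒳
    ... | inj₂ X∈⁅C⁆ = subst (_∈ᶠ 𝒳) (sym (∈ᶠ-⁅⁆⁻ C X X∈⁅C⁆)) C∈𝒳

module UniformMatroid (k n : ℕ) (k≤n : k ≤ n) where

  rk : Subset n → ℕ
  rk = rankU k

  open DerivedMatroid rk

  Independent⇒∣X∣≤k : ∀ X → Independent rk X → ∣ X ∣ ≤ k
  Independent⇒∣X∣≤k X independent = subst (_≤ k) independent (m⊓n≤m k ∣ X ∣)

  IsCircuit⇒∣C∣≡1+k : ∀ {C} → IsCircuit rk C → ∣ C ∣ ≡ suc k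
  IsCircuit⇒∣C∣≡1+k {C} (dependent , minimal) with ∣ C ∣ ≤? suc k
  ... | yes ∣C∣≤1+k = ≤-antisym ∣C∣≤1+k (≰⇒> (dependent ∘ m≥n⇒m⊓n≡n))
  ... | no ∣C∣≰1+k with D , D⊆C , ∣D∣≡1+k ← ∃-⊆-of-size (suc k) C (<⇒≤ (≰⇒> ∣C∣≰1+k)) =
    contradiction (subst (_≤ k) ∣D∣≡1+k (Independent⇒∣X∣≤k D (minimal D D⊆C D≢C))) 1+n≰n
    where
    D≢C : D ≢ C
    D≢C D≡C = ∣C∣≰1+k (≤-reflexive (trans (cong ∣_∣ (sym D≡C)) ∣D∣≡1+k))

  ∣C∣≡1+k⇒IsCircuit : ∀ {C} → ∣ C ∣ ≡ suc k → IsCircuit rk C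
  ∣C∣≡1+k⇒IsCircuit {C} ∣C∣≡1+k = dependent , minimal
    where
    dependent : ¬ Independent rk C
    dependent independent = 1+n≰n (subst (_≤ k) ∣C∣≡1+k (Independent⇒∣X∣≤k C independent))
    minimal : ∀ Y → Y ⊆ C → Y ≢ C → Independent rk Y
    minimal Y Y⊆C Y≢C = m≥n⇒m⊓n≡n (≤-pred (subst (∣ Y ∣ <_) ∣C∣≡1+k
      (≤∧≢⇒< (p⊆q⇒∣p∣≤∣q∣ Y⊆C) (Y≢C ∘ p⊆q∧∣p∣≡∣q∣⇒p≡q Y⊆C))))

  rankM≡k : rankM rk ≡ k
  rankM≡k = trans (cong (k ⊓_) (∣⊤∣≡n n)) (m≤n⇒m⊓n≡m k≤n)

  bound-∁ : ∀ F → (n ∸ rankM rk) ∸ dualRank rk F ≡ ∣ ∁ F ∣ ∸ k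
  bound-∁ F = begin
    (n ∸ rankM rk) ∸ (∣ F ∣ + k ⊓ ∣ ∁ F ∣ ∸ rankM rk)
      ≡⟨ cong₂ (λ m d → (m ∸ d) ∸ (∣ F ∣ + k ⊓ ∣ ∁ F ∣ ∸ d)) (sym (∣p∣+∣∁p∣≡n F)) rankM≡k ⟩
    (∣ F ∣ + ∣ ∁ F ∣ ∸ k) ∸ (∣ F ∣ + k ⊓ ∣ ∁ F ∣ ∸ k)
      ≡⟨ [a+c∸k]∸[a+k⊓c∸k]≡c∸k ∣ F ∣ ∣ ∁ F ∣ k ⟩
    ∣ ∁ F ∣ ∸ k ∎
    where open ≡-Reasoning

  bound≡∣⋃∣∸k : ∀ 𝒜 → bound 𝒜 ≡ ∣ ⋃ᶠ 𝒜 ∣ ∸ k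
  bound≡∣⋃∣∸k 𝒜 = bound-∁ (⋂∁ 𝒜)

  dualRank-cosmall : ∀ F → ∣ ∁ F ∣ ≤ k → dualRank rk F ≡ n ∸ rankM rk
  dualRank-cosmall F ∣∁F∣≤k =
    cong (_∸ rankM rk) (trans (cong (∣ F ∣ +_) (m≥n⇒m⊓n≡n ∣∁F∣≤k)) (∣p∣+∣∁p∣≡n F))

  Overfull⇒∣⋃∣<∣𝒜∣+k : ∀ 𝒜 → Overfull 𝒜 → ∣ ⋃ᶠ 𝒜 ∣ < ∣ 𝒜 ∣ᶠ + k
  Overfull⇒∣⋃∣<∣𝒜∣+k 𝒜 overfull = begin-strict
    ∣ ⋃ᶠ 𝒜 ∣             ≤⟨ m≤n+m∸n ∣ ⋃ᶠ 𝒜 ∣ k ⟩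
    k + (∣ ⋃ᶠ 𝒜 ∣ ∸ k)   <⟨ +-monoʳ-< k (subst (_< ∣ 𝒜 ∣ᶠ) (bound≡∣⋃∣∸k 𝒜) overfull) ⟩
    k + ∣ 𝒜 ∣ᶠ           ≡⟨ +-comm k _ ⟩
    ∣ 𝒜 ∣ᶠ + k           ∎
    where open ≤-Reasoning

  1+k≤∣⋃∣ : ∀ 𝒜 {C} → IsCircuit rk C → C ∈ᶠ 𝒜 → suc k ≤ ∣ ⋃ᶠ 𝒜 ∣
  1+k≤∣⋃∣ 𝒜 {C} circuit C∈𝒜 = subst (_≤ ∣ ⋃ᶠ 𝒜 ∣) (IsCircuit⇒∣C∣≡1+k circuit) (p⊆q⇒∣p∣≤∣q∣ (⊆⋃ᶠ 𝒜 C C∈𝒜))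

  overfull-elimination : OverfullElimination
  overfull-elimination {𝒜₁} {𝒜₂} {C} circuit C∈𝒜₁ C∈𝒜₂ overfull₁ overfull₂ ¬overfull₁₂ =
    subst (_< ∣ R ∣ᶠ) (sym (bound≡∣⋃∣∸k R)) (begin-strict
      ∣ ⋃ᶠ R ∣ ∸ k     ≤⟨ ∸-monoˡ-≤ k (p⊆q⇒∣p∣≤∣q∣ (⋃ᶠ-mono R U (∖ᶠ-⊆ U C))) ⟩
      ∣ ⋃ᶠ U ∣ ∸ k     <⟨ ∸-monoˡ-< ∣⋃U∣<∣R∣+k (≤-trans (n≤1+n k) (1+k≤∣⋃∣ U circuit C∈U)) ⟩
      ∣ R ∣ᶠ + k ∸ k   ≡⟨ m+n∸n≡m _ k ⟩
      ∣ R ∣ᶠ           ∎)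
    where
    open ≤-Reasoning
    U = 𝒜₁ ∪ᶠ 𝒜₂
    I = 𝒜₁ ∩ᶠ 𝒜₂
    R = U ∖ᶠ C
    C∈U : C ∈ᶠ U
    C∈U = ⊆ᶠ-∪ˡ 𝒜₁ 𝒜₂ C C∈𝒜₁
    1+∣R∣+∣I∣≡∣𝒜₁∣+∣𝒜₂∣ : suc ∣ R ∣ᶠ + ∣ I ∣ᶠ ≡ ∣ 𝒜₁ ∣ᶠ + ∣ 𝒜₂ ∣ᶠ
    1+∣R∣+∣I∣≡∣𝒜₁∣+∣𝒜₂∣ =
      trans (cong (_+ ∣ I ∣ᶠ) (sym (∣𝒜∣ᶠ≡1+∣𝒜∖C∣ᶠ U C C∈U))) (count-∪+∩ (allSubsets n) 𝒜₁ 𝒜₂)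
    ∣I∣+k≤∣⋃I∣ : ∣ I ∣ᶠ + k ≤ ∣ ⋃ᶠ I ∣
    ∣I∣+k≤∣⋃I∣ = begin
      ∣ I ∣ᶠ + k                ≤⟨ +-monoˡ-≤ k (subst (∣ I ∣ᶠ ≤_) (bound≡∣⋃∣∸k I) (≮⇒≥ ¬overfull₁₂)) ⟩
      (∣ ⋃ᶠ I ∣ ∸ k) + k
        ≡⟨ m∸n+n≡m (≤-trans (n≤1+n k) (1+k≤∣⋃∣ I circuit (cong₂ _∧_ C∈𝒜₁ C∈𝒜₂))) ⟩
      ∣ ⋃ᶠ I ∣                  ∎
    ∣⋃U∣<∣R∣+k : ∣ ⋃ᶠ U ∣ < ∣ R ∣ᶠ + k
    ∣⋃U∣<∣R∣+k = elimination-arithmetic {∣ 𝒜₁ ∣ᶠ} {∣ 𝒜₂ ∣ᶠ} {∣ I ∣ᶠ} {∣ R ∣ᶠ} 1+∣R∣+∣I∣≡∣𝒜₁∣+∣𝒜₂∣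
      (Overfull⇒∣⋃∣<∣𝒜∣+k 𝒜₁ overfull₁) (Overfull⇒∣⋃∣<∣𝒜∣+k 𝒜₂ overfull₂)
      ∣I∣+k≤∣⋃I∣ (∣⋃ᶠ∣-submodular 𝒜₁ 𝒜₂)

  open WithOverfullElimination overfull-elimination

  Sparse-∪⁅C⁆ : ∀ {ℐ C y} → Sparse ℐ → IsCircuit rk C → y ∈ C → (∀ X → X ∈ᶠ ℐ → y ∉ X) →
                Sparse (ℐ ∪ᶠ ⁅ C ⁆ᶠ)
  Sparse-∪⁅C⁆ {ℐ} {C} {y} sparse circuit y∈C y∉ℐ 𝒜 𝒜⊆ℐ∪C with C ∈ᶠ? 𝒜
  ... | no C∉𝒜 = sparse 𝒜 (⊆ᶠ∪⁅C⁆⇒⊆ᶠ C 𝒜⊆ℐ∪C λ { X X∈𝒜 refl → C∉𝒜 X∈𝒜 })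
  ... | yes C∈𝒜 = begin
    ∣ 𝒜 ∣ᶠ                  ≡⟨ ∣𝒜∣ᶠ≡1+∣𝒜∖C∣ᶠ 𝒜 C C∈𝒜 ⟩
    suc ∣ 𝒜' ∣ᶠ             ≤⟨ s≤s (subst (∣ 𝒜' ∣ᶠ ≤_) (bound≡∣⋃∣∸k 𝒜') (sparse 𝒜' 𝒜'⊆ℐ)) ⟩
    suc (∣ ⋃ᶠ 𝒜' ∣ ∸ k)     ≤⟨ m<n∧o<n⇒m∸o<n∸o ∣⋃𝒜'∣<∣⋃𝒜∣ (1+k≤∣⋃∣ 𝒜 circuit C∈𝒜) ⟩
    ∣ ⋃ᶠ 𝒜 ∣ ∸ k            ≡⟨ bound≡∣⋃∣∸k 𝒜 ⟨
    bound 𝒜              ∎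
    where
    open ≤-Reasoning
    𝒜' = 𝒜 ∖ᶠ C
    𝒜'⊆ℐ : 𝒜' ⊆ᶠ ℐ
    𝒜'⊆ℐ = ⊆ᶠ∪⁅C⁆⇒⊆ᶠ C (λ X → 𝒜⊆ℐ∪C X ∘ ∖ᶠ-⊆ 𝒜 C X) (∈ᶠ-∖⇒≢ 𝒜 C)
    y∉⋃𝒜' : y ∉ ⋃ᶠ 𝒜'
    y∉⋃𝒜' y∈⋃𝒜' with X , X∈𝒜' , y∈X ← ∈⋃ᶠ⁻ 𝒜' y∈⋃𝒜' = y∉ℐ X (𝒜'⊆ℐ X X∈𝒜') y∈X
    ∣⋃𝒜'∣<∣⋃𝒜∣ : ∣ ⋃ᶠ 𝒜' ∣ < ∣ ⋃ᶠ 𝒜 ∣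
    ∣⋃𝒜'∣<∣⋃𝒜∣ = p⊂q⇒∣p∣<∣q∣ (⋃ᶠ-mono 𝒜' 𝒜 (∖ᶠ-⊆ 𝒜 C) , y , ⊆⋃ᶠ 𝒜 C C∈𝒜 y∈C , y∉⋃𝒜')

  Sparse-∅ᶠ : Sparse ∅ᶠ
  Sparse-∅ᶠ 𝒜 𝒜⊆∅ = ≤-trans (≤-trans (∣_∣ᶠ-mono 𝒜 ∅ᶠ 𝒜⊆∅) (≤-reflexive (∣∅ᶠ∣ᶠ≡0 n))) z≤n

  IndependentDM-∅ᶠ : IndependentDM rk ∅ᶠ
  IndependentDM-∅ᶠ = Sparse⇒IndependentDM (λ _ ()) Sparse-∅ᶠ

  circuitsIn : Subset n → Fam n
  circuitsIn X Y = ⌊ ∣ Y ∣ ≟ suc k ⌋ ∧ ⌊ Y ⊆? X ⌋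

  ∈circuitsIn⁻ : ∀ X Y → Y ∈ᶠ circuitsIn X → ∣ Y ∣ ≡ suc k × Y ⊆ X
  ∈circuitsIn⁻ X Y Y∈ with ∣ Y ∣ ≟ suc k | Y ⊆? X
  ... | yes ∣Y∣≡1+k | yes Y⊆X = ∣Y∣≡1+k , Y⊆X

  ∈circuitsIn⁺ : ∀ X Y → ∣ Y ∣ ≡ suc k → Y ⊆ X → Y ∈ᶠ circuitsIn X
  ∈circuitsIn⁺ X Y ∣Y∣≡1+k Y⊆X with ∣ Y ∣ ≟ suc k | Y ⊆? X
  ... | yes _ | yes _ = refl
  ... | no ∣Y∣≢1+k | _ = contradiction ∣Y∣≡1+k ∣Y∣≢1+k
  ... | yes _ | no Y⊈X = contradiction (λ {x} → Y⊆X {x}) Y⊈X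

  circuitsIn-OfCircuits : ∀ X → OfCircuits rk (circuitsIn X)
  circuitsIn-OfCircuits X C C∈ = ∣C∣≡1+k⇒IsCircuit (proj₁ (∈circuitsIn⁻ X C C∈))

  circuitsIn-mono : ∀ {X Y} → X ⊆ Y → circuitsIn X ⊆ᶠ circuitsIn Y
  circuitsIn-mono {X} {Y} X⊆Y C C∈ with ∣C∣≡1+k , C⊆X ← ∈circuitsIn⁻ X C C∈ =
    ∈circuitsIn⁺ Y C ∣C∣≡1+k (⊆-trans C⊆X X⊆Y)

  ∃-Sparse-in-circuitsIn : ∀ m X → k + m ≤ ∣ X ∣ →
    Σ (Fam n) λ ℐ → ℐ ⊆ᶠ circuitsIn X × Sparse ℐ × ∣ ℐ ∣ᶠ ≡ m
  ∃-Sparse-in-circuitsIn zero X _ = ∅ᶠ , (λ _ ()) , Sparse-∅ᶠ , ∣∅ᶠ∣ᶠ≡0 n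
  ∃-Sparse-in-circuitsIn (suc m) X k+1+m≤∣X∣ = extend (0<∣p∣⇒Nonempty (≤-trans (s≤s z≤n) 1+k≤∣X∣))
    where
    1+k+m≤∣X∣ : suc (k + m) ≤ ∣ X ∣
    1+k+m≤∣X∣ = subst (_≤ ∣ X ∣) (+-suc k m) k+1+m≤∣X∣
    1+k≤∣X∣ : suc k ≤ ∣ X ∣
    1+k≤∣X∣ = ≤-trans (s≤s (m≤m+n k m)) 1+k+m≤∣X∣
    extend : Nonempty X → Σ (Fam n) λ ℐ → ℐ ⊆ᶠ circuitsIn X × Sparse ℐ × ∣ ℐ ∣ᶠ ≡ suc m
    extend (x , x∈X)
      with ℐ , ℐ⊆ , sparse , ∣ℐ∣≡m ← ∃-Sparse-in-circuitsIn m (X - x)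
             (≤-pred (subst (suc (k + m) ≤_) (sym (1+∣p-x∣≡∣p∣ x∈X)) 1+k+m≤∣X∣))
         | C , C⊆X , ∣C∣≡1+k , x∈C ← ∃-⊆-of-size-∋ k x∈X 1+k≤∣X∣ =
      let x∉ℐ : ∀ Y → Y ∈ᶠ ℐ → x ∉ Y
          x∉ℐ Y Y∈ℐ = x∉p-x X ∘ proj₂ (∈circuitsIn⁻ (X - x) Y (ℐ⊆ Y Y∈ℐ))
      in ℐ ∪ᶠ ⁅ C ⁆ᶠ ,
         ∪ᶠ-⊆ (⊆ᶠ-trans ℐ⊆ (circuitsIn-mono (p─q⊆p X ⁅ x ⁆))) (⁅⁆ᶠ-⊆ (∈circuitsIn⁺ X C ∣C∣≡1+k C⊆X)) ,
         Sparse-∪⁅C⁆ sparse (∣C∣≡1+k⇒IsCircuit ∣C∣≡1+k) x∈C x∉ℐ ,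
         trans (∣𝒜∪⁅C⁆ᶠ∣ᶠ≡1+∣𝒜∣ᶠ ℐ C (λ C∈ℐ → x∉ℐ C C∈ℐ x∈C)) (cong suc ∣ℐ∣≡m)

  RankDMIs-circuitsIn : ∀ X → RankDMIs rk (circuitsIn X) (∣ X ∣ ∸ k)
  RankDMIs-circuitsIn X = spanning , maximal
    where
    spanning : Σ (Fam n) λ ℐ → ℐ ⊆ᶠ circuitsIn X × IndependentDM rk ℐ × ∣ ℐ ∣ᶠ ≡ ∣ X ∣ ∸ k
    spanning with k ≤? ∣ X ∣
    ... | yes k≤∣X∣ with ℐ , ℐ⊆ , sparse , ∣ℐ∣≡∣X∣∸k ← ∃-Sparse-in-circuitsIn (∣ X ∣ ∸ k) X
                                                          (≤-reflexive (m+[n∸m]≡n k≤∣X∣)) =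
      ℐ , ℐ⊆ , Sparse⇒IndependentDM (OfCircuits-⊆ ℐ⊆ (circuitsIn-OfCircuits X)) sparse , ∣ℐ∣≡∣X∣∸k
    ... | no k≰∣X∣ =
      ∅ᶠ , (λ _ ()) , IndependentDM-∅ᶠ , trans (∣∅ᶠ∣ᶠ≡0 n) (sym (m≤n⇒m∸n≡0 (<⇒≤ (≰⇒> k≰∣X∣))))
    maximal : ∀ ℐ → ℐ ⊆ᶠ circuitsIn X → IndependentDM rk ℐ → ∣ ℐ ∣ᶠ ≤ ∣ X ∣ ∸ k
    maximal ℐ ℐ⊆ independent = begin
      ∣ ℐ ∣ᶠ          ≤⟨ IndependentDM⇒Sparse independent ℐ ⊆ᶠ-refl ⟩
      bound ℐ      ≡⟨ bound≡∣⋃∣∸k ℐ ⟩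
      ∣ ⋃ᶠ ℐ ∣ ∸ k    ≤⟨ ∸-monoˡ-≤ k (p⊆q⇒∣p∣≤∣q∣ (⋃ᶠ-least ℐ λ Y → proj₂ ∘ ∈circuitsIn⁻ X Y ∘ ℐ⊆ Y)) ⟩
      ∣ X ∣ ∸ k       ∎
      where open ≤-Reasoning

  IndependentDM-∪⁅C⁆ : ∀ {ℐ C y} → IndependentDM rk ℐ → IsCircuit rk C → y ∈ C → (∀ X → X ∈ᶠ ℐ → y ∉ X) →
                       IndependentDM rk (ℐ ∪ᶠ ⁅ C ⁆ᶠ) × ∣ ℐ ∪ᶠ ⁅ C ⁆ᶠ ∣ᶠ ≡ suc ∣ ℐ ∣ᶠ
  IndependentDM-∪⁅C⁆ {ℐ} {C} independent circuit y∈C y∉ℐ =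
    Sparse⇒IndependentDM (OfCircuits-∪⁅⁆ (proj₁ independent) circuit)
      (Sparse-∪⁅C⁆ (IndependentDM⇒Sparse independent) circuit y∈C y∉ℐ) ,
    ∣𝒜∪⁅C⁆ᶠ∣ᶠ≡1+∣𝒜∣ᶠ ℐ C (λ C∈ℐ → y∉ℐ C C∈ℐ y∈C)

  IsFlatDM-circuitsIn : ∀ X → IsFlatDM rk (circuitsIn X)
  IsFlatDM-circuitsIn X = circuitsIn-OfCircuits X , λ C circuit →
    mk⇔ (λ C∈ → ∈⇒InClDM circuit C∈ (RankDMIs-circuitsIn X)) (InClDM⇒∈ circuit)
    where
    InClDM⇒∈ : ∀ {C} → IsCircuit rk C → InClDM rk (circuitsIn X) C → C ∈ᶠ circuitsIn X
    InClDM⇒∈ {C} circuit (_ , r , ((ℐ , ℐ⊆ , independent , ∣ℐ∣≡r) , _) , (_ , maximal))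
      with C ∈ᶠ? circuitsIn X
    ... | yes C∈ = C∈
    ... | no C∉
      with y , y∈C , y∉X ← ∃-∈-∉ (λ C⊆X → C∉ (∈circuitsIn⁺ X C (IsCircuit⇒∣C∣≡1+k circuit) C⊆X))
                 with independent′ , ∣ℐ∪C∣≡1+∣ℐ∣ ← IndependentDM-∪⁅C⁆ independent circuit y∈C
                      (λ Y Y∈ℐ → y∉X ∘ proj₂ (∈circuitsIn⁻ X Y (ℐ⊆ Y Y∈ℐ))) =
      contradiction (subst₂ _≤_ (trans ∣ℐ∪C∣≡1+∣ℐ∣ (cong suc ∣ℐ∣≡r)) refl
                      (maximal (ℐ ∪ᶠ ⁅ C ⁆ᶠ) (∪ᶠ-mono ℐ⊆ ⊆ᶠ-refl) independent′)) 1+n≰n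

  circuitsIn-circuit : ∀ {C} → IsCircuit rk C → circuitsIn C ≐ ⁅ C ⁆ᶠ
  circuitsIn-circuit {C} circuit = ⊆ᶠ-antisym
    (λ Y Y∈ → let ∣Y∣≡1+k , Y⊆C = ∈circuitsIn⁻ C Y Y∈ in
      subst (_∈ᶠ ⁅ C ⁆ᶠ) (sym (p⊆q∧∣p∣≡∣q∣⇒p≡q Y⊆C (trans ∣Y∣≡1+k (sym ∣C∣≡1+k)))) (∈ᶠ-⁅⁆⁺ C))
    (⁅⁆ᶠ-⊆ (∈circuitsIn⁺ C C ∣C∣≡1+k ⊆-refl))
    where
    ∣C∣≡1+k = IsCircuit⇒∣C∣≡1+k circuit

  IsClDM-circuitsIn-⁅C⁆ : ∀ {C} → IsCircuit rk C → IsClDM rk (circuitsIn C) ⁅ C ⁆ᶠ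
  IsClDM-circuitsIn-⁅C⁆ {C} circuit = IsClDM-cong (circuitsIn-circuit circuit) (IsFlatDM-circuitsIn C)

  InClDM-⁅C⁆⇔≡ : ∀ {C D} → IsCircuit rk C → IsCircuit rk D → InClDM rk ⁅ C ⁆ᶠ D ⇔ D ≡ C
  InClDM-⁅C⁆⇔≡ {C} {D} circuitC circuitD = mk⇔
    (λ D∈clC → ∈ᶠ-⁅⁆⁻ C D (trans (sym (circuitsIn-circuit circuitC D)) (Equivalence.from clC D∈clC)))
    (λ { refl → Equivalence.to clC (∈circuitsIn⁺ C C (IsCircuit⇒∣C∣≡1+k circuitC) ⊆-refl) })
    where
    clC = proj₂ (IsClDM-circuitsIn-⁅C⁆ circuitC) D circuitD

  distinct-circuits⇒¬RankDMIs-1 : ∀ {𝒳 C D} → IsCircuit rk C → IsCircuit rk D → D ≢ C →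
                                  C ∈ᶠ 𝒳 → D ∈ᶠ 𝒳 → ¬ RankDMIs rk 𝒳 1
  distinct-circuits⇒¬RankDMIs-1 {𝒳} {C} {D} circuitC circuitD D≢C C∈𝒳 D∈𝒳 (_ , maximal)
    with x , x∈C ← 0<∣p∣⇒Nonempty (subst (0 <_) (sym (IsCircuit⇒∣C∣≡1+k circuitC)) (s≤s z≤n))
    with y , y∈D , y∉C ← ∃-∈-∉ (λ D⊆C → D≢C (p⊆q∧∣p∣≡∣q∣⇒p≡q D⊆C
                             (trans (IsCircuit⇒∣C∣≡1+k circuitD) (sym (IsCircuit⇒∣C∣≡1+k circuitC)))))
    with independent₁ , ∣ℐ₁∣≡1 ← IndependentDM-∪⁅C⁆ IndependentDM-∅ᶠ circuitC x∈C (λ _ ())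
    with independent₂ , ∣ℐ₂∣≡2 ← IndependentDM-∪⁅C⁆ independent₁ circuitD y∈D
                                       (λ Y Y∈ℐ₁ → subst (y ∉_) (sym (∈ᶠ-⁅⁆⁻ C Y Y∈ℐ₁)) y∉C) =
    contradiction (subst (_≤ 1) (trans ∣ℐ₂∣≡2 (cong suc (trans ∣ℐ₁∣≡1 (cong suc (∣∅ᶠ∣ᶠ≡0 n)))))
                    (maximal _ (∪ᶠ-⊆ (∪ᶠ-⊆ (λ _ ()) (⁅⁆ᶠ-⊆ C∈𝒳)) (⁅⁆ᶠ-⊆ D∈𝒳)) independent₂))
                  1+n≰n

  IsAtomDM⇒IsClDM-⁅C⁆ : ∀ 𝒳 → IsAtomDM rk 𝒳 → Σ (Subset n) λ C → IsCircuit rk C × IsClDM rk 𝒳 ⁅ C ⁆ᶠ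
  IsAtomDM⇒IsClDM-⁅C⁆ 𝒳 ((oc , _) , rank1@((ℐ , ℐ⊆𝒳 , independent , ∣ℐ∣≡1) , _))
    with C , C∈ℐ ← count>0⇒nonempty {𝒜 = ℐ} (allSubsets n) (subst (0 <_) (sym ∣ℐ∣≡1) (s≤s z≤n)) =
    C , circuitC , oc , λ D circuitD → mk⇔
      (λ D∈𝒳 → Equivalence.from (InClDM-⁅C⁆⇔≡ circuitC circuitD)
                 (decidable-stable (D ≟ˢ C) λ D≢C →
                    distinct-circuits⇒¬RankDMIs-1 circuitC circuitD D≢C C∈𝒳 D∈𝒳 rank1))
      (λ D∈clC → subst (_∈ᶠ 𝒳) (sym (Equivalence.to (InClDM-⁅C⁆⇔≡ circuitC circuitD) D∈clC)) C∈𝒳)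
    where
    circuitC = proj₁ independent C C∈ℐ
    C∈𝒳 = ℐ⊆𝒳 C C∈ℐ

  IsFlat-dual⇒1+k≤∣∁F∣ : ∀ {F g} → IsFlat (dualRank rk) F → g ∉ F → suc k ≤ ∣ ∁ F ∣
  IsFlat-dual⇒1+k≤∣∁F∣ {F} {g} flat g∉F with suc k ≤? ∣ ∁ F ∣
  ... | yes 1+k≤∣∁F∣ = 1+k≤∣∁F∣
  ... | no 1+k≰∣∁F∣ = contradiction
    (trans (dualRank-cosmall (F ∪ ⁅ g ⁆) ∣∁[F∪g]∣≤k) (sym (dualRank-cosmall F ∣∁F∣≤k)))
    (flat g g∉F)
    where
    ∣∁F∣≤k : ∣ ∁ F ∣ ≤ k
    ∣∁F∣≤k = ≤-pred (≰⇒> 1+k≰∣∁F∣)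
    ∣∁[F∪g]∣≤k : ∣ ∁ (F ∪ ⁅ g ⁆) ∣ ≤ k
    ∣∁[F∪g]∣≤k = ≤-trans (p⊆q⇒∣p∣≤∣q∣ (p⊆q⇒∁p⊇∁q (p⊆p∪q {p = F} ⁅ g ⁆))) ∣∁F∣≤k

  circuitsIn-∁-⊆⇔ : ∀ {F G} → IsFlat (dualRank rk) F → G ⊆ F ⇔ circuitsIn (∁ F) ⊆ᶠ circuitsIn (∁ G)
  circuitsIn-∁-⊆⇔ {F} {G} flatF = mk⇔ (circuitsIn-mono ∘ p⊆q⇒∁p⊇∁q) G⊆F
    where
    G⊆F : circuitsIn (∁ F) ⊆ᶠ circuitsIn (∁ G) → G ⊆ F
    G⊆F ⊆ᶠ {g} g∈G with g ∈? F
    ... | yes g∈F = g∈F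
    ... | no g∉F
      with C , C⊆∁F , ∣C∣≡1+k , g∈C ← ∃-⊆-of-size-∋ k (x∉p⇒x∈∁p g∉F) (IsFlat-dual⇒1+k≤∣∁F∣ flatF g∉F) =
      contradiction g∈G
        (x∈∁p⇒x∉p (proj₂ (∈circuitsIn⁻ (∁ G) C (⊆ᶠ C (∈circuitsIn⁺ (∁ F) C ∣C∣≡1+k C⊆∁F))) g∈C))

  RankDMIs-circuitsIn-circuit : ∀ {C} → IsCircuit rk C → RankDMIs rk (circuitsIn C) 1
  RankDMIs-circuitsIn-circuit {C} circuit =
    subst (RankDMIs rk (circuitsIn C)) (trans (cong (_∸ k) (IsCircuit⇒∣C∣≡1+k circuit)) (m+n∸n≡m 1 k))
      (RankDMIs-circuitsIn C)

  IsClDM-⁅⁆-injective : ∀ {𝒳 C D} → IsCircuit rk C → IsCircuit rk D →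
                        IsClDM rk 𝒳 ⁅ C ⁆ᶠ → IsClDM rk 𝒳 ⁅ D ⁆ᶠ → D ≡ C
  IsClDM-⁅⁆-injective {C = C} {D} circuitC circuitD (_ , clC) (_ , clD) =
    Equivalence.to (InClDM-⁅C⁆⇔≡ circuitC circuitD)
      (Equivalence.to (clC D circuitD)
        (Equivalence.from (clD D circuitD) (Equivalence.from (InClDM-⁅C⁆⇔≡ circuitD circuitD) refl)))

theorem6p5 : (k n : ℕ) → k ≤ n → IsAdjointDM {n} (rankU k)
theorem6p5 k n k≤n =
  (λ C circuit →
    circuitsIn C , IsClDM-circuitsIn-⁅C⁆ circuit , IsFlatDM-circuitsIn C , RankDMIs-circuitsIn-circuit circuit) ,
  (λ C D 𝒳 circuitC circuitD clC clD → cong ∁ (sym (IsClDM-⁅⁆-injective circuitC circuitD clC clD))) ,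
  IsAtomDM⇒IsClDM-⁅C⁆ ,
  (λ F → circuitsIn (∁ F)) ,
  (λ F _ → IsFlatDM-circuitsIn (∁ F)) ,
  (λ F G flatF _ → circuitsIn-∁-⊆⇔ flatF) ,
  (λ F _ → subst (RankDMIs rk (circuitsIn (∁ F))) (sym (bound-∁ F)) (RankDMIs-circuitsIn (∁ F))) ,
  λ C circuit →
    subst (λ X → IsClDM rk (circuitsIn X) ⁅ C ⁆ᶠ) (sym (¬-involutive C)) (IsClDM-circuitsIn-⁅C⁆ circuit)
  where
  open UniformMatroid k n k≤n
  open BooleanAlgebra (∪-∩-booleanAlgebra n) using (¬-involutive)
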